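{- Let $(G,k,h)$ be an instance of $\mathcal{T}_{h+1}$-Free Edge Deletion, let $X\subseteq V(G)$ with $|X|=\ell$ be such that $G-X$ is a disjoint union of cliques, and let $C$ be a connected component of $G-X$. Partition $V(C)$ into classes $P_1,\dots,P_{2^\ell}$ so that $u,v\in V(C)$ lie in the same class iff $N(u)\cap X=N(v)\cap X$. Suppose $|P_i|\ge \ell(h-1)+h$ for some $i$, let $S\subseteq P_i$ be an arbitrary set of $h$ vertices, let $G'=G-S$ and $k'=k-h\cdot(|V(C)|-h+|N_X(P_i)|)$. Then $(G,k,h)$ is a yes-instance if and only if $(G',k',h)$ is a yes-instance (in particular, if $k'<0$ then $(G,k,h)$ is a no-instance).
   Context: $\mathcal{T}_{h+1}$-Free Edge Deletion: given a simple undirected graph $G$ and integers $k,h$, decide whether there is $F\subseteq E(G)$ with $|F|\le k$ such that every connected component of $G\setminus F$ has at most $h$ vertices (no such $F$ exists when $k<0$). $N_X(P_i)$ is the set of vertices of $X$ adjacent to some vertex of $P_i$. -}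

module Defs where

open import Data.Nat using (ℕ; _≤_)
open import Data.Integer as ℤ using (ℤ; +_)
open import Data.Bool using (Bool; true; false; _∧_; not)
open import Data.Fin using (Fin; toℕ)
open import Data.Fin.Subset using (Subset; _∈_; _∉_; _∩_; ⊤; ∁; ∣_∣)
open import Data.Vec using (lookup; tabulate)
open import Data.List using (List; length; filterᵇ; concatMap; map; allFin)
open import Data.Bool.ListAction using (any)
open import Data.List.Relation.Unary.All using (All)
open import Data.List.Relation.Unary.Unique.Propositional using (Unique)
open import Data.Product using (Σ; _×_; _,_; proj₁; proj₂)
open import Relation.Binary.PropositionalEquality using (_≡_; _≢_)
open import Relation.Nullary.Decidable using (⌊_⌋)
import Data.Nat as ℕ

record Graph (n : ℕ) : Set where
  field
    adj   : Fin n → Fin n → Bool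
    sym   : ∀ u v → adj u v ≡ adj v u
    irrefl : ∀ u → adj u u ≡ false
open Graph public

_∈ᵇ_ : ∀ {n} → Fin n → Subset n → Bool
v ∈ᵇ W = lookup W v

data Reach {n : ℕ} (E : Fin n → Fin n → Bool) : Fin n → Fin n → Set where
  here : ∀ {u} → Reach E u u
  step : ∀ {u w v} → E u w ≡ true → Reach E w v → Reach E u v

induced : ∀ {n} → Graph n → Subset n → Fin n → Fin n → Bool
induced G W u v = adj G u v ∧ (u ∈ᵇ W) ∧ (v ∈ᵇ W)

-- Every connected component of the graph (W, E) (E only relating vertices of W)
-- has at most h vertices: no h+1 distinct vertices lie in one component.
ComponentsAtMost : ∀ {n} → Subset n → (Fin n → Fin n → Bool) → ℕ → Set
ComponentsAtMost {n} W E h =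
  ∀ (v : Fin n) → v ∈ W → (xs : List (Fin n)) → Unique xs →
  All (Reach E v) xs → length xs ≤ h

allPairs : ∀ n → List (Fin n × Fin n)
allPairs n = concatMap (λ u → map (λ v → (u , v)) (allFin n)) (allFin n)

pairCount : ∀ {n} → (Fin n → Fin n → Bool) → ℕ
pairCount {n} F =
  length (filterᵇ (λ p → ⌊ toℕ (proj₁ p) ℕ.<? toℕ (proj₂ p) ⌋ ∧ F (proj₁ p) (proj₂ p))
                  (allPairs n))

record DeletionSet {n} (G : Graph n) (W : Subset n) : Set where
  field
    del    : Fin n → Fin n → Bool
    delSym : ∀ u v → del u v ≡ del v u
    del⊆E  : ∀ u v → del u v ≡ true → induced G W u v ≡ true
open DeletionSet public

remaining : ∀ {n} (G : Graph n) (W : Subset n) → DeletionSet G W → Fin n → Fin n → Bool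
remaining G W F u v = induced G W u v ∧ not (del F u v)

-- (G[W], k, h) is a yes-instance of T_{h+1}-Free Edge Deletion:
-- some F ⊆ E(G[W]) with |F| ≤ k such that every component of G[W] \ F has ≤ h vertices.
-- (k is an integer; for k < 0 there is no such F.)
YesInstance : ∀ {n} → Graph n → Subset n → ℤ → ℕ → Set
YesInstance G W k h =
  Σ (DeletionSet G W) λ F →
    (+ pairCount (del F) ℤ.≤ k) × ComponentsAtMost W (remaining G W F) h

-- G - X is a disjoint union of cliques: any two distinct vertices of the same
-- connected component of G - X are adjacent.
ClusterAfterDeleting : ∀ {n} → Graph n → Subset n → Set
ClusterAfterDeleting G X =
  ∀ u v → u ∉ X → v ∉ X → Reach (induced G (∁ X)) u v → u ≢ v → adj G u v ≡ true

IsComponentOf : ∀ {n} → Graph n → Subset n → Subset n → Set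
IsComponentOf {n} G X C =
  Σ (Fin n) (λ c → c ∈ C) ×
  (∀ u v → u ∈ C → (v ∈ C → v ∉ X × Reach (induced G (∁ X)) u v)
                 × (v ∉ X → Reach (induced G (∁ X)) u v → v ∈ C))

nbhd : ∀ {n} → Graph n → Fin n → Subset n
nbhd G v = tabulate (adj G v)

NX : ∀ {n} → Graph n → Subset n → Subset n → Subset n
NX {n} G X P = tabulate (λ x → (x ∈ᵇ X) ∧ any (λ p → (p ∈ᵇ P) ∧ adj G p x) (allFin n))

-- Instead of deletion sets we compare labellings of the vertices.  Deleting the edges between
-- different classes of a labelling whose classes have at most h vertices gives a solution, and the
-- components of any solution form such a labelling with no more cut edges.
-- Call a vertex of C free if its class avoids X; the class of a free vertex lies in the clique C.
-- Moving a free vertex into another free class that is at least as large and not full cuts fewer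
-- edges, so an optimal labelling has at most one free class with fewer than h vertices.  A vertex of
-- X shares its class with at most h - 1 vertices of P, so at least h vertices of P are free, and some
-- free class has exactly h vertices.  Exchanging two free vertices of C, or two twins in P, keeps the
-- number of cut edges and turns this class into S.  Then every edge leaving S is cut, and there are
-- h (|C| - h + |N_X(P)|) of them.  Conversely, adding the class S to a solution of G - S costs
-- exactly these edges.
module Submission where

open import Data.Bool as Bool using (Bool; true; false; _∧_; _∨_; not; if_then_else_)
open import Data.Bool.ListAction using (any)
open import Data.Bool.Properties using (∧-identityʳ; ∧-zeroʳ; ∧-comm; ∨-identityʳ; ∨-zeroʳ)
open import Data.Fin as Fin using (Fin; zero; suc; toℕ)
open import Data.Fin.Permutation as Perm using (Permutation; _⟨$⟩ʳ_)
open import Data.Fin.Permutation.Components using (transpose)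
open import Data.Fin.Properties as Finₚ using (any?; toℕ-injective)
open import Data.Fin.Subset using (Subset; _∈_; _∉_; _⊆_; _∩_; ⊤; ∁; ∣_∣)
open import Data.Fin.Subset.Properties using (∈⊤)
open import Data.Integer as ℤ using (ℤ; +_)
import Data.Integer.Properties as ℤₚ
open import Data.Integer.Tactic.RingSolver renaming (solve-∀ to ℤ-solve-∀)
open import Data.List as List using (List; []; _∷_; length; filterᵇ; concatMap; map; allFin; tabulate)
open import Data.List.Membership.Propositional using () renaming (_∈_ to _∈ₗ_)
open import Data.List.Membership.Propositional.Properties using (∈-allFin)
open import Data.List.Properties using (filter-++; length-++; map-tabulate)
open import Data.List.Relation.Unary.All as All using (All; []; _∷_)
open import Data.List.Relation.Unary.All.Properties using (all-filter)
open import Data.List.Relation.Unary.AllPairs using ([]; _∷_)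
open import Data.List.Relation.Unary.Any using (here; there)
open import Data.List.Relation.Unary.Unique.Propositional using (Unique)
import Data.List.Relation.Unary.Unique.Propositional.Properties as Uniqueₚ
open import Data.Nat as ℕ using (ℕ; zero; suc; _+_; _*_; _∸_; _≤_; _<_; _≡ᵇ_; z≤n; s≤s)
open import Data.Nat.Induction using (<-wellFounded)
open import Data.Nat.Properties
open import Data.Nat.Tactic.RingSolver using (solve-∀)
open import Data.Product using (Σ-syntax; ∃-syntax; _×_; _,_; proj₁; proj₂)
open import Data.Sum using (_⊎_; inj₁; inj₂)
open import Data.Vec using ([]; _∷_)
open import Data.Vec.Properties using (lookup⇒[]=; []=⇒lookup; lookup-map; lookup-replicate; lookup-zipWith; lookup∘tabulate)
open import Function using (_∘_)
open import Function.Bundles using (_⇔_; mk⇔)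
open import Induction.WellFounded using (Acc; acc)
open import Relation.Binary.PropositionalEquality
open import Relation.Nullary using (contradiction; Dec; ¬_)
open import Relation.Nullary.Decidable using (does; yes; no; dec-true; dec-false; ⌊_⌋; _×-dec_; ¬?)
open import Algebra.Properties.CommutativeMonoid.Sum +-0-commutativeMonoid
open import Algebra.Properties.Semiring.Sum +-*-semiring using (*-distribʳ-sum)
open import Defs renaming (sym to adj-sym)

∧-true⁻ : ∀ {a b} → a ∧ b ≡ true → a ≡ true × b ≡ true
∧-true⁻ {true} b≡true = refl , b≡true

not-true⁻ : ∀ {a} → not a ≡ true → a ≡ false
not-true⁻ {false} _ = refl

≡true-⇔⇒≡ : ∀ {a b} → (a ≡ true → b ≡ true) → (b ≡ true → a ≡ true) → a ≡ b
≡true-⇔⇒≡ {true}  a⇒b b⇒a = sym (a⇒b refl)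
≡true-⇔⇒≡ {false} {false} a⇒b b⇒a = refl
≡true-⇔⇒≡ {false} {true}  a⇒b b⇒a = b⇒a refl

∧-false⇒false : ∀ {a b} → a ∧ b ≡ false → b ≡ true → a ≡ false
∧-false⇒false {false} _       _ = refl
∧-false⇒false {true}  a∧b≡false refl = a∧b≡false

does-true⁻ : ∀ {A : Set} (d : Dec A) → does d ≡ true → A
does-true⁻ (yes a) _ = a

does-false⁻ : ∀ {A : Set} (d : Dec A) → does d ≡ false → ¬ A
does-false⁻ (no ¬a) _ = ¬a

≡ᵇ-sym : ∀ a b → (a ≡ᵇ b) ≡ (b ≡ᵇ a)
≡ᵇ-sym a b = ≡true-⇔⇒≡ (λ e → dec-true (b ℕ.≟ a) (sym (does-true⁻ (a ℕ.≟ b) e)))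
                       (λ e → dec-true (a ℕ.≟ b) (sym (does-true⁻ (b ℕ.≟ a) e)))

∧-≡ᵇ-false⇒≢ : ∀ {b m m′} → (b ∧ (m ≡ᵇ m′)) ≡ false → b ≡ true → m ≢ m′
∧-≡ᵇ-false⇒≢ {m = m} {m′} b∧m≡m′ b≡true m≡m′ =
  contradiction (trans (sym b∧m≡m′) (cong₂ _∧_ b≡true (dec-true (m ℕ.≟ m′) m≡m′))) λ ()

∧-not-∧-true⁻ : ∀ {a b} → a ∧ not (a ∧ not b) ≡ true → a ≡ true × b ≡ true
∧-not-∧-true⁻ {true} {true} _ = refl , refl

_==_ : ∀ {n} → Fin n → Fin n → Bool
i == j = does (i Fin.≟ j)

χ : Bool → ℕ
χ true  = 1
χ false = 0

χ≤1 : ∀ b → χ b ≤ 1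
χ≤1 true  = ≤-refl
χ≤1 false = z≤n

χ-∧≤ˡ : ∀ a b → χ (a ∧ b) ≤ χ a
χ-∧≤ˡ true  b = χ≤1 b
χ-∧≤ˡ false b = z≤n

χ-∧≤ʳ : ∀ a b → χ (a ∧ b) ≤ χ b
χ-∧≤ʳ true  b = ≤-refl
χ-∧≤ʳ false b = z≤n

χ-split : ∀ a b → χ a ≡ χ (a ∧ b) + χ (a ∧ not b)
χ-split true  true  = refl
χ-split true  false = refl
χ-split false b     = refl

count : ∀ {n} → (Fin n → Bool) → ℕ
count p = sum (λ i → χ (p i))

sum-mono : ∀ {n} {f g : Fin n → ℕ} → (∀ i → f i ≤ g i) → sum f ≤ sum g
sum-mono {zero}  f≤g = z≤n
sum-mono {suc n} f≤g = +-mono-≤ (f≤g zero) (sum-mono (f≤g ∘ suc))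

sum-mono-< : ∀ {n} {f g : Fin n → ℕ} → (∀ i → f i ≤ g i) → ∀ j → f j < g j → sum f < sum g
sum-mono-< f≤g zero    f<g = +-mono-<-≤ f<g (sum-mono (λ i → f≤g (suc i)))
sum-mono-< f≤g (suc j) f<g = +-mono-≤-< (f≤g zero) (sum-mono-< (λ i → f≤g (suc i)) j f<g)

sum-≥-entry : ∀ {n} (f : Fin n → ℕ) i → f i ≤ sum f
sum-≥-entry f zero    = m≤m+n _ _
sum-≥-entry f (suc i) = ≤-trans (sum-≥-entry (λ j → f (suc j)) i) (m≤n+m _ _)

count≤n : ∀ {n} (p : Fin n → Bool) → count p ≤ n
count≤n {zero}  p = z≤n
count≤n {suc n} p = +-mono-≤ (χ≤1 (p zero)) (count≤n (λ i → p (suc i)))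

sum-update : ∀ {n} (f g : Fin n → ℕ) j → (∀ i → i ≢ j → f i ≡ g i) → sum f + g j ≡ sum g + f j
sum-update f g zero    f≗g =
  trans (cong (λ s → f zero + s + g zero) (sum-cong-≗ λ i → f≗g (suc i) λ ())) (swap-ends (f zero) _ (g zero))
  where
  swap-ends : ∀ a b c → a + b + c ≡ c + b + a
  swap-ends = solve-∀
sum-update f g (suc j) f≗g =
  begin
    f zero + sum (λ i → f (suc i)) + g (suc j)   ≡⟨ +-assoc (f zero) _ _ ⟩
    f zero + (sum (λ i → f (suc i)) + g (suc j))
      ≡⟨ cong₂ _+_ (f≗g zero λ ()) (sum-update _ _ j (λ i i≢j → f≗g (suc i) (i≢j ∘ Finₚ.suc-injective))) ⟩
    g zero + (sum (λ i → g (suc i)) + f (suc j)) ≡⟨ +-assoc (g zero) _ _ ⟨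
    g zero + sum (λ i → g (suc i)) + f (suc j)   ∎
  where open ≡-Reasoning

sum-<-witness : ∀ {n} (f g : Fin n → ℕ) → sum f < sum g → Σ[ i ∈ Fin n ] f i < g i
sum-<-witness {zero}  f g ()
sum-<-witness {suc n} f g f<g with f zero <? g zero
... | yes f₀<g₀ = zero , f₀<g₀
... | no  f₀≮g₀ with sum-<-witness (λ i → f (suc i)) (λ i → g (suc i))
                                   (+-cancelˡ-< (g zero) _ _ (≤-<-trans (+-monoˡ-≤ _ (≮⇒≥ f₀≮g₀)) f<g))
...   | i , fᵢ<gᵢ = suc i , fᵢ<gᵢ

count-<-witness : ∀ {n} (p q : Fin n → Bool) → count p < count q → Σ[ i ∈ Fin n ] p i ≡ false × q i ≡ true
count-<-witness p q p<q with sum-<-witness _ _ p<q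
... | i , χp<χq with p i in pᵢ | q i in qᵢ
...   | false | true  = i , pᵢ , qᵢ
...   | false | false = contradiction χp<χq λ ()
...   | true  | true  = contradiction χp<χq (<-irrefl refl)

count-insert : ∀ {n} (p q : Fin n → Bool) j → p j ≡ false → q j ≡ true → (∀ i → i ≢ j → q i ≡ p i) →
               count q ≡ suc (count p)
count-insert p q j pⱼ qⱼ q≗p =
  begin
    count q               ≡⟨ +-identityʳ _ ⟨
    count q + 0           ≡⟨ cong (λ b → count q + χ b) pⱼ ⟨
    count q + χ (p j)     ≡⟨ sum-update _ _ j (λ i i≢j → cong χ (q≗p i i≢j)) ⟩
    count p + χ (q j)     ≡⟨ cong (λ b → count p + χ b) qⱼ ⟩
    count p + 1           ≡⟨ +-comm _ 1 ⟩
    suc (count p)         ∎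
  where open ≡-Reasoning

halve-≤ : ∀ {x y} → x + x ≤ y + y → x ≤ y
halve-≤ 2x≤2y = ≮⇒≥ λ y<x → <⇒≱ (+-mono-< y<x y<x) 2x≤2y

+≤⇒≤- : ∀ a b {k : ℤ} → + (a + b) ℤ.≤ k → + a ℤ.≤ k ℤ.- + b
+≤⇒≤- a b {k} a+b≤k =
  subst (ℤ._≤ k ℤ.- + b) (cancel (+ a) (+ b)) (ℤₚ.+-monoˡ-≤ (ℤ.- + b) (subst (ℤ._≤ k) (ℤₚ.pos-+ a b) a+b≤k))
  where
  cancel : ∀ x y → x ℤ.+ y ℤ.- y ≡ x
  cancel = ℤ-solve-∀

≤-⇒+≤ : ∀ a b {k : ℤ} → + a ℤ.≤ k ℤ.- + b → + (a + b) ℤ.≤ k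
≤-⇒+≤ a b {k} a≤k-b = subst₂ ℤ._≤_ (sym (ℤₚ.pos-+ a b)) (cancel k (+ b)) (ℤₚ.+-monoˡ-≤ (+ b) a≤k-b)
  where
  cancel : ∀ x y → x ℤ.- y ℤ.+ y ≡ x
  cancel = ℤ-solve-∀

two-moves-cancel : ∀ c c₁ c₂ a b → c₁ + 2 + (b + b) ≡ c + ((a + 1) + (a + 1)) →
                   c₂ + 2 + (a + a) ≡ c₁ + ((b + 1) + (b + 1)) → c₂ ≡ c
two-moves-cancel c c₁ c₂ a b first second = +-cancelʳ-≡ (2 + (a + a)) _ _
  (begin
    c₂ + (2 + (a + a))         ≡⟨ +-assoc c₂ 2 _ ⟨
    c₂ + 2 + (a + a)           ≡⟨ second ⟩
    c₁ + ((b + 1) + (b + 1))   ≡⟨ regroup c₁ b ⟩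
    c₁ + 2 + (b + b)           ≡⟨ first ⟩
    c + ((a + 1) + (a + 1))    ≡⟨ regroup′ c a ⟩
    c + (2 + (a + a))          ∎)
  where
  open ≡-Reasoning
  regroup : ∀ x y → x + ((y + 1) + (y + 1)) ≡ x + 2 + (y + y)
  regroup = solve-∀
  regroup′ : ∀ x y → x + ((y + 1) + (y + 1)) ≡ x + (2 + (y + y))
  regroup′ = solve-∀

-- Transpositions

module _ {n} (i j : Fin n) where

  transpose-matchˡ : transpose i j i ≡ j
  transpose-matchˡ rewrite dec-true (i Fin.≟ i) refl = refl

  transpose-matchʳ : transpose i j j ≡ i
  transpose-matchʳ with j Fin.≟ i
  ... | yes j≡i = j≡i
  ... | no  _   rewrite dec-true (j Fin.≟ j) refl = refl

  transpose-other : ∀ {k} → k ≢ i → k ≢ j → transpose i j k ≡ k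
  transpose-other {k} k≢i k≢j rewrite dec-false (k Fin.≟ i) k≢i | dec-false (k Fin.≟ j) k≢j = refl

  transpose-involutive : ∀ k → transpose i j (transpose i j k) ≡ k
  transpose-involutive k = by-cases (k Fin.≟ i) (k Fin.≟ j)
    where
    by-cases : Dec (k ≡ i) → Dec (k ≡ j) → transpose i j (transpose i j k) ≡ k
    by-cases (yes refl) _          = trans (cong (transpose i j) transpose-matchˡ) transpose-matchʳ
    by-cases (no _)     (yes refl) = trans (cong (transpose i j) transpose-matchʳ) transpose-matchˡ
    by-cases (no k≢i)   (no k≢j)   = trans (cong (transpose i j) (transpose-other k≢i k≢j)) (transpose-other k≢i k≢j)

transpose-twins : ∀ {n} {A : Set} (f : Fin n → Fin n → A) (p q : Fin n) → (∀ a b → f a b ≡ f b a) →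
                  f p p ≡ f q q → (∀ v → v ≢ p → v ≢ q → f p v ≡ f q v) →
                  ∀ a b → f (transpose p q a) (transpose p q b) ≡ f a b
transpose-twins f p q f-sym diag twins a b =
  trans (adjoint a (transpose p q b)) (cong (f a) (transpose-involutive p q b))
  where
  τ = transpose p q
  τ-other : ∀ {x} → x ≢ p → x ≢ q → τ x ≡ x
  τ-other = transpose-other p q
  adjoint : ∀ a c → f (τ a) c ≡ f a (τ c)
  adjoint a c = by-cases (a Fin.≟ p) (a Fin.≟ q) (c Fin.≟ p) (c Fin.≟ q)
    where
    via : ∀ {a′ c′} → τ a ≡ a′ → c′ ≡ τ c → f a′ c ≡ f a c′ → f (τ a) c ≡ f a (τ c)
    via τa c′ middle = trans (cong (λ x → f x c) τa) (trans middle (cong (f a) c′))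
    τp = transpose-matchˡ p q
    τq = transpose-matchʳ p q
    by-cases : Dec (a ≡ p) → Dec (a ≡ q) → Dec (c ≡ p) → Dec (c ≡ q) → f (τ a) c ≡ f a (τ c)
    by-cases (yes refl) _          (yes refl) _          = via τp (sym τp) (f-sym q p)
    by-cases (yes refl) _          (no _)     (yes refl) = via τp (sym τq) (sym diag)
    by-cases (yes refl) _          (no c≢p)   (no c≢q)   = via τp (sym (τ-other c≢p c≢q)) (sym (twins c c≢p c≢q))
    by-cases (no _)     (yes refl) (yes refl) _          = via τq (sym τp) diag
    by-cases (no _)     (yes refl) (no _)     (yes refl) = via τq (sym τq) (f-sym p q)
    by-cases (no _)     (yes refl) (no c≢p)   (no c≢q)   = via τq (sym (τ-other c≢p c≢q)) (twins c c≢p c≢q)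
    by-cases (no a≢p)   (no a≢q)   (yes refl) _          =
      via (τ-other a≢p a≢q) (sym τp) (trans (f-sym a p) (trans (twins a a≢p a≢q) (f-sym q a)))
    by-cases (no a≢p)   (no a≢q)   (no _)     (yes refl) =
      via (τ-other a≢p a≢q) (sym τq) (trans (f-sym a q) (trans (sym (twins a a≢p a≢q)) (f-sym p a)))
    by-cases (no a≢p)   (no a≢q)   (no c≢p)   (no c≢q)   = via (τ-other a≢p a≢q) (sym (τ-other c≢p c≢q)) refl

-- Connected components

Reach-trans : ∀ {n} {E : Fin n → Fin n → Bool} {u v w} → Reach E u v → Reach E v w → Reach E u w
Reach-trans here         r = r
Reach-trans (step e r) r′ = step e (Reach-trans r r′)

firstTrue : ∀ {m} → (Fin m → Bool) → ℕ
firstTrue {zero}  p = 0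
firstTrue {suc m} p = if p zero then 0 else suc (firstTrue (λ i → p (suc i)))

firstTrue-cong : ∀ {m} {p q : Fin m → Bool} → (∀ i → p i ≡ q i) → firstTrue p ≡ firstTrue q
firstTrue-cong {zero}          p≗q = refl
firstTrue-cong {suc m} {p} {q} p≗q rewrite p≗q zero with q zero
... | true  = refl
... | false = cong suc (firstTrue-cong (λ i → p≗q (suc i)))

firstTrue-sound : ∀ {m} (p : Fin m → Bool) i → p i ≡ true → Σ[ j ∈ Fin m ] toℕ j ≡ firstTrue p × p j ≡ true
firstTrue-sound {suc m} p i pᵢ with p zero in p₀
firstTrue-sound {suc m} p i       pᵢ | true  = zero , refl , p₀
firstTrue-sound {suc m} p zero    pᵢ | false = contradiction (trans (sym pᵢ) p₀) λ ()
firstTrue-sound {suc m} p (suc i) pᵢ | false with firstTrue-sound (λ j → p (suc j)) i pᵢ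
... | j , j≡first , pⱼ = suc j , cong suc j≡first , pⱼ

module Components {n} (E : Fin n → Fin n → Bool) (E-sym : ∀ u v → E u v ≡ E v u) where

  Reach-sym : ∀ {u v} → Reach E u v → Reach E v u
  Reach-sym here               = here
  Reach-sym (step {u} {w} e r) = Reach-trans (Reach-sym r) (step (trans (E-sym w u) e) here)

  private
    Closed : (Fin n → Bool) → Set
    Closed R = ∀ u v → E u v ≡ true → R v ≡ true → R u ≡ true

    record Saturation (t : Fin n) : Set where
      field
        members : Fin n → Bool
        sound   : ∀ u → members u ≡ true → Reach E u t
        root    : members t ≡ true
        closed  : Closed members

    Escape : (Fin n → Bool) → Fin n → Fin n → Bool
    Escape R u v = E u v ∧ (R v ∧ not (R u))

    escape? : ∀ R → (∃[ u ] ∃[ v ] Escape R u v ≡ true) ⊎ Closed R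
    escape? R with any? (λ u → any? (λ v → Escape R u v Bool.≟ true))
    ... | yes (u , v , esc) = inj₁ (u , v , esc)
    ... | no ¬esc           = inj₂ closed
      where
      closed : Closed R
      closed u v e Rv with R u in Ru
      ... | true  = refl
      ... | false = contradiction (u , v , esc) ¬esc
        where
        esc : Escape R u v ≡ true
        esc rewrite e | Rv | Ru = refl

    -- Each round adds a vertex to R, so fuel n suffices.
    saturate : ∀ t fuel R → (∀ u → R u ≡ true → Reach E u t) → R t ≡ true → n ≤ count R + fuel → Saturation t
    saturate t fuel R sound Rt n≤ with escape? R
    ... | inj₂ closed = record { members = R ; sound = sound ; root = Rt ; closed = closed }
    ... | inj₁ (u , v , esc) with ∧-true⁻ esc
    ...   | e , esc′ with ∧-true⁻ esc′
    ...     | Rv , ¬Ru = continue fuel n≤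
      where
      R′ : Fin n → Bool
      R′ x = R x ∨ (x == u)

      count-R′ : count R′ ≡ suc (count R)
      count-R′ = count-insert R R′ u (not-true⁻ ¬Ru) (trans (cong (R u ∨_) (dec-true (u Fin.≟ u) refl)) (∨-zeroʳ (R u)))
                   (λ i i≢u → trans (cong (R i ∨_) (dec-false (i Fin.≟ u) i≢u)) (∨-identityʳ (R i)))

      sound′ : ∀ x → R′ x ≡ true → Reach E x t
      sound′ x R′x with R x in Rx
      ... | true  = sound x Rx
      ... | false with x Fin.≟ u
      ...   | yes refl = step e (sound v Rv)

      continue : ∀ fuel → n ≤ count R + fuel → Saturation t
      continue zero    n≤ = contradiction (subst (_≤ n) count-R′ (count≤n R′))
                                          (<⇒≱ (s≤s (subst (n ≤_) (+-identityʳ _) n≤)))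
      continue (suc f) n≤ = saturate t f R′ sound′ (cong (_∨ (t == u)) Rt)
                                     (≤-trans n≤ (≤-reflexive (trans (+-suc _ f) (cong (_+ f) (sym count-R′)))))

    saturated : ∀ t → Saturation t
    saturated t = saturate t n (_== t) start-sound (dec-true (t Fin.≟ t) refl) (m≤n+m n _)
      where
      start-sound : ∀ u → (u == t) ≡ true → Reach E u t
      start-sound u u==t with u Fin.≟ t
      ... | yes refl = here

  componentOf : Fin n → Fin n → Bool
  componentOf t = Saturation.members (saturated t)

  componentOf-sound : ∀ {u t} → componentOf t u ≡ true → Reach E u t
  componentOf-sound {u} {t} = Saturation.sound (saturated t) u

  componentOf-complete : ∀ {u t} → Reach E u t → componentOf t u ≡ true
  componentOf-complete {t = t} here       = Saturation.root (saturated t)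
  componentOf-complete {t = t} (step e r) = Saturation.closed (saturated t) _ _ e (componentOf-complete r)

  -- Components are labelled by the index of their first vertex.
  component : Fin n → ℕ
  component t = firstTrue (componentOf t)

  Reach⇒component≡ : ∀ {u v} → Reach E u v → component u ≡ component v
  Reach⇒component≡ {u} {v} u↝v = firstTrue-cong {p = componentOf u} {componentOf v} λ w → ≡true-⇔⇒≡
    (λ w∈u → componentOf-complete (Reach-trans (componentOf-sound w∈u) u↝v))
    (λ w∈v → componentOf-complete (Reach-trans (componentOf-sound w∈v) (Reach-sym u↝v)))

  component≡⇒Reach : ∀ {u v} → component u ≡ component v → Reach E u v
  component≡⇒Reach {u} {v} u≡v
    with firstTrue-sound (componentOf u) u (componentOf-complete here)
       | firstTrue-sound (componentOf v) v (componentOf-complete here)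
  ... | j , j≡u , j∈u | j′ , j′≡v , j′∈v with toℕ-injective (trans j≡u (trans u≡v (sym j′≡v)))
  ...   | refl = Reach-trans (Reach-sym (componentOf-sound j∈u)) (componentOf-sound j′∈v)

∈⇒∈ᵇ : ∀ {n} {v : Fin n} {W : Subset n} → v ∈ W → (v ∈ᵇ W) ≡ true
∈⇒∈ᵇ = []=⇒lookup

∈ᵇ⇒∈ : ∀ {n} {v : Fin n} {W : Subset n} → (v ∈ᵇ W) ≡ true → v ∈ W
∈ᵇ⇒∈ {v = v} {W} = lookup⇒[]= v W

∉⇒∈ᵇ : ∀ {n} {v : Fin n} {W : Subset n} → v ∉ W → (v ∈ᵇ W) ≡ false
∉⇒∈ᵇ {v = v} {W} v∉W with v ∈ᵇ W in v∈W
... | false = refl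
... | true  = contradiction (∈ᵇ⇒∈ v∈W) v∉W

∈ᵇ⇒∉ : ∀ {n} {v : Fin n} {W : Subset n} → (v ∈ᵇ W) ≡ false → v ∉ W
∈ᵇ⇒∉ v∉W v∈W = contradiction (trans (sym (∈⇒∈ᵇ v∈W)) v∉W) λ ()

∈ᵇ-∁ : ∀ {n} (W : Subset n) v → (v ∈ᵇ ∁ W) ≡ not (v ∈ᵇ W)
∈ᵇ-∁ W v = lookup-map v not W

∈ᵇ-⊤ : ∀ {n} (v : Fin n) → (v ∈ᵇ ⊤) ≡ true
∈ᵇ-⊤ v = lookup-replicate v true

∣∣≡count : ∀ {n} (W : Subset n) → ∣ W ∣ ≡ count (_∈ᵇ W)
∣∣≡count []          = refl
∣∣≡count (true ∷ W)  = cong suc (∣∣≡count W)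
∣∣≡count (false ∷ W) = ∣∣≡count W

length-filterᵇ-tabulate : ∀ {A : Set} {n} (p : A → Bool) (f : Fin n → A) →
                          length (filterᵇ p (tabulate f)) ≡ count (p ∘ f)
length-filterᵇ-tabulate {n = zero}  p f = refl
length-filterᵇ-tabulate {n = suc n} p f with p (f zero)
... | true  = cong suc (length-filterᵇ-tabulate p (f ∘ suc))
... | false = length-filterᵇ-tabulate p (f ∘ suc)

length-filterᵇ-concatMap : ∀ {A B : Set} {n} (p : B → Bool) (g : A → List B) (f : Fin n → A) →
  length (filterᵇ p (concatMap g (tabulate f))) ≡ sum (λ i → length (filterᵇ p (g (f i))))
length-filterᵇ-concatMap {n = zero}  p g f = refl
length-filterᵇ-concatMap {n = suc n} p g f =
  begin
    length (filterᵇ p (g (f zero) List.++ concatMap g (tabulate (f ∘ suc))))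
      ≡⟨ cong length (filter-++ _ (g (f zero)) _) ⟩
    length (filterᵇ p (g (f zero)) List.++ filterᵇ p (concatMap g (tabulate (f ∘ suc))))
      ≡⟨ length-++ (filterᵇ p (g (f zero))) ⟩
    length (filterᵇ p (g (f zero))) + length (filterᵇ p (concatMap g (tabulate (f ∘ suc))))
      ≡⟨ cong (λ z → length (filterᵇ p (g (f zero))) + z) (length-filterᵇ-concatMap p g (f ∘ suc)) ⟩
    sum (λ i → length (filterᵇ p (g (f i)))) ∎
  where open ≡-Reasoning

module _ {n} (d : Fin n → Fin n → Bool) where

  private
    _≺_ : Fin n → Fin n → Bool
    u ≺ v = ⌊ toℕ u ℕ.<? toℕ v ⌋

    ordered : Fin n × Fin n → Bool
    ordered uv = proj₁ uv ≺ proj₂ uv ∧ d (proj₁ uv) (proj₂ uv)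

  pairCount≡sum : pairCount d ≡ sum λ u → count λ v → u ≺ v ∧ d u v
  pairCount≡sum =
    trans (length-filterᵇ-concatMap ordered (λ u → map (u ,_) (allFin n)) (λ u → u))
          (sum-cong-≗ λ u → trans (cong (length ∘ filterᵇ ordered) (map-tabulate (λ v → v) (u ,_)))
                                  (length-filterᵇ-tabulate ordered (u ,_)))

  pairCount-double : (∀ u v → d u v ≡ d v u) → (∀ u → d u u ≡ false) →
                     pairCount d + pairCount d ≡ sum λ u → count (d u)
  pairCount-double d-sym d-irrefl =
    begin
      pairCount d + pairCount d
        ≡⟨ cong₂ _+_ pairCount≡sum (trans pairCount≡sum (∑-comm (λ u v → χ (u ≺ v ∧ d u v)))) ⟩
      sum (λ u → count λ v → u ≺ v ∧ d u v) + sum (λ u → count λ v → v ≺ u ∧ d v u)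
        ≡⟨ ∑-distrib-+ (λ u → count λ v → u ≺ v ∧ d u v) _ ⟨
      sum (λ u → count (λ v → u ≺ v ∧ d u v) + count (λ v → v ≺ u ∧ d v u))
        ≡⟨ sum-cong-≗ (λ u → ∑-distrib-+ (λ v → χ (u ≺ v ∧ d u v)) _) ⟨
      sum (λ u → sum λ v → χ (u ≺ v ∧ d u v) + χ (v ≺ u ∧ d v u))
        ≡⟨ sum-cong-≗ (λ u → sum-cong-≗ (λ v → split u v)) ⟩
      sum (λ u → count (d u)) ∎
    where
    open ≡-Reasoning
    split : ∀ u v → χ (u ≺ v ∧ d u v) + χ (v ≺ u ∧ d v u) ≡ χ (d u v)
    split u v with toℕ u ℕ.<? toℕ v | toℕ v ℕ.<? toℕ u
    ... | yes u<v | yes v<u = contradiction v<u (<-asym u<v)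
    ... | yes _   | no _    = +-identityʳ _
    ... | no _    | yes _   = cong χ (d-sym v u)
    ... | no u≮v  | no v≮u with toℕ-injective (≤-antisym (≮⇒≥ v≮u) (≮⇒≥ u≮v))
    ...   | refl = cong χ (sym (d-irrefl u))

unique-length≤count : ∀ {n} (p : Fin n → Bool) {xs} → Unique xs → All (λ u → p u ≡ true) xs → length xs ≤ count p
unique-length≤count p []                 []          = z≤n
unique-length≤count p {x ∷ xs} (x∉xs ∷ uniq) (px ∷ pxs) =
  subst (suc (length xs) ≤_) (sym (count-insert p′ p x p′x px p≗p′))
        (s≤s (unique-length≤count p′ uniq (All.zipWith (λ (x≢y , py) → p′-intro py (x≢y ∘ sym)) (x∉xs , pxs))))
  where
  p′ : Fin _ → Bool
  p′ u = p u ∧ not (u == x)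
  p′x : p′ x ≡ false
  p′x rewrite dec-true (x Fin.≟ x) refl = ∧-zeroʳ (p x)
  p≗p′ : ∀ u → u ≢ x → p u ≡ p′ u
  p≗p′ u u≢x rewrite dec-false (u Fin.≟ x) u≢x = sym (∧-identityʳ (p u))
  p′-intro : ∀ {u} → p u ≡ true → u ≢ x → p′ u ≡ true
  p′-intro {u} pu u≢x = trans (sym (p≗p′ u u≢x)) pu

-- Labellings

-- Vertices with the same label form a class.
Labelling : ℕ → Set
Labelling n = Fin n → ℕ

-- Every cut edge is counted twice, once per orientation.
cut : ∀ {n} → (Fin n → Fin n → Bool) → Labelling n → ℕ
cut E lab = sum λ a → sum λ b → χ (E a b ∧ not (lab a ≡ᵇ lab b))

cut-cong : ∀ {n} (E : Fin n → Fin n → Bool) {lab lab′ : Labelling n} → (∀ x → lab x ≡ lab′ x) → cut E lab ≡ cut E lab′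
cut-cong E lab≗lab′ = sum-cong-≗ λ a → sum-cong-≗ λ b → cong (λ z → χ (E a b ∧ not z)) (cong₂ _≡ᵇ_ (lab≗lab′ a) (lab≗lab′ b))

module _ {n} (E : Fin n → Fin n → Bool) where

  row : Labelling n → Fin n → ℕ
  row lab u = count λ b → E u b ∧ not (lab u ≡ᵇ lab b)

  -- Relabelling one vertex u only changes row u and column u of the cut matrix.
  cut-update : (∀ a b → E a b ≡ E b a) → (∀ a → E a a ≡ false) →
               ∀ lab lab′ u → (∀ w → w ≢ u → lab w ≡ lab′ w) →
               cut E lab + (row lab′ u + row lab′ u) ≡ cut E lab′ + (row lab u + row lab u)
  cut-update E-sym E-irrefl lab lab′ u agree =
    begin
      cut E lab + (row lab′ u + row lab′ u)   ≡⟨ +-assoc (cut E lab) _ _ ⟨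
      cut E lab + row lab′ u + row lab′ u     ≡⟨ cong (_+ row lab′ u) (sum-columns F F′ (F-sym lab′ u)) ⟨
      sum s + row lab′ u                      ≡⟨ cong (λ z → sum s + z) (+-identityʳ _) ⟨
      sum s + (row lab′ u + 0)                ≡⟨ cong (λ z → sum s + (row lab′ u + z)) (diagonal lab) ⟨
      sum s + (row lab′ u + F u u)            ≡⟨ sum-update s s′ u s≗s′ ⟩
      sum s′ + (row lab u + F′ u u)           ≡⟨ cong (λ z → sum s′ + (row lab u + z)) (diagonal lab′) ⟩
      sum s′ + (row lab u + 0)                ≡⟨ cong (λ z → sum s′ + z) (+-identityʳ _) ⟩
      sum s′ + row lab u                      ≡⟨ cong (_+ row lab u) (sum-columns F′ F (F-sym lab u)) ⟩
      cut E lab′ + row lab u + row lab u      ≡⟨ +-assoc (cut E lab′) _ _ ⟩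
      cut E lab′ + (row lab u + row lab u)    ∎
    where
    open ≡-Reasoning
    F F′ : Fin n → Fin n → ℕ
    F  a b = χ (E a b ∧ not (lab a ≡ᵇ lab b))
    F′ a b = χ (E a b ∧ not (lab′ a ≡ᵇ lab′ b))
    F-sym : ∀ l b a → χ (E a b ∧ not (l a ≡ᵇ l b)) ≡ χ (E b a ∧ not (l b ≡ᵇ l a))
    F-sym l b a = cong₂ (λ e q → χ (e ∧ not q)) (E-sym a b) (≡ᵇ-sym (l a) (l b))
    diagonal : ∀ l → χ (E u u ∧ not (l u ≡ᵇ l u)) ≡ 0
    diagonal l = cong (λ e → χ (e ∧ _)) (E-irrefl u)
    s s′ : Fin n → ℕ
    s  a = sum (F a) + F′ a u
    s′ a = sum (F′ a) + F a u
    sum-columns : ∀ (H H′ : Fin n → Fin n → ℕ) → (∀ a → H′ a u ≡ H′ u a) →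
                  sum (λ a → sum (H a) + H′ a u) ≡ sum (λ a → sum (H a)) + sum (H′ u)
    sum-columns H H′ H′-sym = trans (∑-distrib-+ (λ a → sum (H a)) _) (cong (λ z → sum (λ a → sum (H a)) + z) (sum-cong-≗ H′-sym))
    s≗s′ : ∀ a → a ≢ u → s a ≡ s′ a
    s≗s′ a a≢u = sum-update (F a) (F′ a) u λ b b≢u → cong (λ z → χ (E a b ∧ not z)) (cong₂ _≡ᵇ_ (agree a a≢u) (agree b b≢u))

  cut-permute : (π : Permutation n n) → (∀ a b → E (π ⟨$⟩ʳ a) (π ⟨$⟩ʳ b) ≡ E a b) →
                ∀ lab → cut E (lab ∘ (π ⟨$⟩ʳ_)) ≡ cut E lab
  cut-permute π π-auto lab = sym
    (begin
      cut E lab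
        ≡⟨ ∑-permute (λ a → sum (F a)) π ⟩
      sum (λ a → sum (F (π ⟨$⟩ʳ a)))
        ≡⟨ sum-cong-≗ (λ a → ∑-permute (F (π ⟨$⟩ʳ a)) π) ⟩
      sum (λ a → sum λ b → F (π ⟨$⟩ʳ a) (π ⟨$⟩ʳ b))
        ≡⟨ sum-cong-≗ (λ a → sum-cong-≗ λ b → cong (λ e → χ (e ∧ _)) (π-auto a b)) ⟩
      cut E (lab ∘ (π ⟨$⟩ʳ_)) ∎)
    where
    open ≡-Reasoning
    F : Fin n → Fin n → ℕ
    F a b = χ (E a b ∧ not (lab a ≡ᵇ lab b))

count-permute : ∀ {n} (π : Permutation n n) (p : Fin n → Bool) → count (p ∘ (π ⟨$⟩ʳ_)) ≡ count p
count-permute π p = sym (∑-permute (χ ∘ p) π)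

classSize : ∀ {n} → Labelling n → ℕ → ℕ
classSize lab ℓ = count λ v → lab v ≡ᵇ ℓ

relabel : ∀ {n} → Labelling n → Fin n → ℕ → Labelling n
relabel lab u ℓ w = if w == u then ℓ else lab w

module _ {n} (lab : Labelling n) (u : Fin n) (ℓ : ℕ) where

  relabel-self : relabel lab u ℓ u ≡ ℓ
  relabel-self rewrite dec-true (u Fin.≟ u) refl = refl

  relabel-other : ∀ {w} → w ≢ u → relabel lab u ℓ w ≡ lab w
  relabel-other {w} w≢u rewrite dec-false (w Fin.≟ u) w≢u = refl

  classSize-relabel : ∀ m → classSize (relabel lab u ℓ) m + χ (lab u ≡ᵇ m) ≡ classSize lab m + χ (ℓ ≡ᵇ m)
  classSize-relabel m =
    begin
      classSize (relabel lab u ℓ) m + χ (lab u ≡ᵇ m)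
        ≡⟨ sum-update _ _ u (λ w w≢u → cong (λ l → χ (l ≡ᵇ m)) (relabel-other w≢u)) ⟩
      classSize lab m + χ (relabel lab u ℓ u ≡ᵇ m)
        ≡⟨ cong (λ l → classSize lab m + χ (l ≡ᵇ m)) relabel-self ⟩
      classSize lab m + χ (ℓ ≡ᵇ m) ∎
    where open ≡-Reasoning

  classSize-leave : ℓ ≢ lab u → classSize (relabel lab u ℓ) (lab u) + 1 ≡ classSize lab (lab u)
  classSize-leave ℓ≢u =
    begin
      classSize (relabel lab u ℓ) (lab u) + 1
        ≡⟨ cong (λ b → classSize (relabel lab u ℓ) (lab u) + χ b) (dec-true (lab u ℕ.≟ lab u) refl) ⟨
      classSize (relabel lab u ℓ) (lab u) + χ (lab u ≡ᵇ lab u) ≡⟨ classSize-relabel (lab u) ⟩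
      classSize lab (lab u) + χ (ℓ ≡ᵇ lab u)
        ≡⟨ cong (λ b → classSize lab (lab u) + χ b) (dec-false (ℓ ℕ.≟ lab u) ℓ≢u) ⟩
      classSize lab (lab u) + 0                          ≡⟨ +-identityʳ _ ⟩
      classSize lab (lab u)                              ∎
    where open ≡-Reasoning

  classSize-join : ℓ ≢ lab u → classSize (relabel lab u ℓ) ℓ ≡ classSize lab ℓ + 1
  classSize-join ℓ≢u =
    begin
      classSize (relabel lab u ℓ) ℓ                      ≡⟨ +-identityʳ _ ⟨
      classSize (relabel lab u ℓ) ℓ + 0
        ≡⟨ cong (λ b → classSize (relabel lab u ℓ) ℓ + χ b) (dec-false (lab u ℕ.≟ ℓ) (ℓ≢u ∘ sym)) ⟨
      classSize (relabel lab u ℓ) ℓ + χ (lab u ≡ᵇ ℓ)      ≡⟨ classSize-relabel ℓ ⟩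
      classSize lab ℓ + χ (ℓ ≡ᵇ ℓ)                       ≡⟨ cong (λ b → classSize lab ℓ + χ b) (dec-true (ℓ ℕ.≟ ℓ) refl) ⟩
      classSize lab ℓ + 1                                ∎
    where open ≡-Reasoning

-- Solutions as labellings

module _ {n} (G : Graph n) (W : Subset n) where

  ClassesAtMost : Labelling n → ℕ → Set
  ClassesAtMost lab h = ∀ v → v ∈ W → count (λ u → (u ∈ᵇ W) ∧ (lab u ≡ᵇ lab v)) ≤ h

  induced-sym : ∀ u v → induced G W u v ≡ induced G W v u
  induced-sym u v rewrite adj-sym G u v | ∧-comm (u ∈ᵇ W) (v ∈ᵇ W) = refl

  induced⇒adj : ∀ {u v} → induced G W u v ≡ true → adj G u v ≡ true
  induced⇒adj {u} {v} = proj₁ ∘ ∧-true⁻ {adj G u v}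

  induced⇒∈ʳ : ∀ {u v} → induced G W u v ≡ true → (v ∈ᵇ W) ≡ true
  induced⇒∈ʳ {u} {v} uv = proj₂ (∧-true⁻ {u ∈ᵇ W} (proj₂ (∧-true⁻ {adj G u v} uv)))

  del-irrefl : (F : DeletionSet G W) → ∀ u → del F u u ≡ false
  del-irrefl F u with del F u u in d
  ... | false = refl
  ... | true  = contradiction (trans (sym (induced⇒adj (del⊆E F u u d))) (irrefl G u)) λ ()

  remaining⇒adj : (F : DeletionSet G W) → ∀ {u v} → remaining G W F u v ≡ true → adj G u v ≡ true
  remaining⇒adj F {u} {v} = induced⇒adj ∘ proj₁ ∘ ∧-true⁻ {induced G W u v}

  remaining-sym : (F : DeletionSet G W) → ∀ u v → remaining G W F u v ≡ remaining G W F v u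
  remaining-sym F u v = cong₂ (λ a b → a ∧ not b) (induced-sym u v) (delSym F u v)

  separate : Labelling n → DeletionSet G W
  separate lab = record
    { del    = λ u v → induced G W u v ∧ not (lab u ≡ᵇ lab v)
    ; delSym = λ u v → cong₂ (λ a b → a ∧ not b) (induced-sym u v) (≡ᵇ-sym (lab u) (lab v))
    ; del⊆E  = λ u v → proj₁ ∘ ∧-true⁻ {induced G W u v}
    }

  pairCount-separate : ∀ lab → pairCount (del (separate lab)) + pairCount (del (separate lab)) ≡ cut (induced G W) lab
  pairCount-separate lab = pairCount-double _ (delSym (separate lab)) (del-irrefl (separate lab))

  Reach-separate : ∀ lab {u v} → Reach (remaining G W (separate lab)) u v → (u ∈ᵇ W) ≡ true →
                   (v ∈ᵇ W) ≡ true × lab u ≡ lab v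
  Reach-separate lab here                   u∈W = u∈W , refl
  Reach-separate lab {u} (step {w = w} e r) u∈W with ∧-not-∧-true⁻ {induced G W u w} e
  ... | uw , same with Reach-separate lab r (induced⇒∈ʳ uw)
  ...   | v∈W , w≡v = v∈W , trans (does-true⁻ (lab u ℕ.≟ lab w) same) w≡v

  separate-components : ∀ lab h → ClassesAtMost lab h → ComponentsAtMost W (remaining G W (separate lab)) h
  separate-components lab h classes v v∈W xs uniq reach =
    ≤-trans (unique-length≤count _ uniq (All.map same-class reach)) (classes v v∈W)
    where
    same-class : ∀ {u} → Reach (remaining G W (separate lab)) v u → ((u ∈ᵇ W) ∧ (lab u ≡ᵇ lab v)) ≡ true
    same-class r with Reach-separate lab r (∈⇒∈ᵇ v∈W)
    ... | u∈W , v≡u rewrite u∈W = dec-true (_ ℕ.≟ _) (sym v≡u)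

  module Solution (F : DeletionSet G W) where

    open Components (remaining G W F) (remaining-sym F) public using (component; component≡⇒Reach; Reach⇒component≡; Reach-sym)

    kept-edge : ∀ {u v} → induced G W u v ≡ true → del F u v ≡ false → remaining G W F u v ≡ true
    kept-edge uv d = cong₂ (λ a b → a ∧ not b) uv d

    cut-component : cut (induced G W) component ≤ pairCount (del F) + pairCount (del F)
    cut-component =
      ≤-trans (sum-mono λ u → sum-mono λ v → cut⇒deleted u v)
              (≤-reflexive (sym (pairCount-double (del F) (delSym F) (del-irrefl F))))
      where
      cut⇒deleted : ∀ u v → χ (induced G W u v ∧ not (component u ≡ᵇ component v)) ≤ χ (del F u v)
      cut⇒deleted u v with del F u v in d
      ... | true = χ≤1 _
      ... | false with induced G W u v in uv
      ...   | false = z≤n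
      ...   | true rewrite dec-true (component u ℕ.≟ component v) (Reach⇒component≡ (step (kept-edge uv d) here)) = z≤n

    component-classes : ∀ h → ComponentsAtMost W (remaining G W F) h → ClassesAtMost component h
    component-classes h components v v∈W =
      subst (_≤ h) (length-filterᵇ-tabulate p (λ u → u))
            (components v v∈W (filterᵇ p (allFin n)) (Uniqueₚ.filter⁺ _ (Uniqueₚ.allFin⁺ n))
                        (All.map reach (all-filter _ (allFin n))))
      where
      p : Fin n → Bool
      p u = (u ∈ᵇ W) ∧ (component u ≡ᵇ component v)
      reach : ∀ {u} → Bool.T (p u) → Reach (remaining G W F) v u
      reach {u} pu with u ∈ᵇ W | component u ≡ᵇ component v in same
      ... | true | true = Reach-sym (component≡⇒Reach (does-true⁻ (component u ℕ.≟ component v) same))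

YesInstance⇒1≤h : ∀ {n} {G : Graph n} {W k h} → YesInstance G W k h → ∀ {v} → v ∈ W → 1 ≤ h
YesInstance⇒1≤h (_ , _ , components) {v} v∈W = components v v∈W (v ∷ []) ([] ∷ []) (here ∷ [])

-- The reduction

-- P is the class P_i of the statement and T the common neighbourhood N(v) ∩ X of its vertices.
record Setting {n} (G : Graph n) (X C T P S : Subset n) (h : ℕ) : Set where
  field
    C∩X-empty : ∀ v → (v ∈ᵇ C) ≡ true → (v ∈ᵇ X) ≡ false
    C-closed  : ∀ u v → (u ∈ᵇ C) ≡ true → adj G u v ≡ true → (v ∈ᵇ X) ≡ false → (v ∈ᵇ C) ≡ true
    C-clique  : ∀ u v → (u ∈ᵇ C) ≡ true → (v ∈ᵇ C) ≡ true → u ≢ v → adj G u v ≡ true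
    P⊆C       : ∀ v → (v ∈ᵇ P) ≡ true → (v ∈ᵇ C) ≡ true
    P-nbhd    : ∀ p x → (p ∈ᵇ P) ≡ true → (x ∈ᵇ X) ≡ true → adj G p x ≡ (x ∈ᵇ T)
    T⊆X       : ∀ x → (x ∈ᵇ T) ≡ true → (x ∈ᵇ X) ≡ true
    S⊆P       : ∀ v → (v ∈ᵇ S) ≡ true → (v ∈ᵇ P) ≡ true
    |S|≡h     : count (_∈ᵇ S) ≡ h
    P-large   : count (_∈ᵇ X) * (h ∸ 1) + h ≤ count (_∈ᵇ P)

module Reduction {n} {G : Graph n} {X C T P S : Subset n} {h : ℕ} (σ : Setting G X C T P S h) where

  open Setting σ

  C≢X : ∀ {c x} → (c ∈ᵇ C) ≡ true → (x ∈ᵇ X) ≡ true → c ≢ x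
  C≢X c∈C x∈X refl = contradiction (trans (sym x∈X) (C∩X-empty _ c∈C)) λ ()

  C-nonadjacent : ∀ {u v} → (u ∈ᵇ C) ≡ true → (v ∈ᵇ C) ≡ false → (v ∈ᵇ X) ≡ false → adj G u v ≡ false
  C-nonadjacent {u} {v} u∈C v∉C v∉X with adj G u v in uv
  ... | false = refl
  ... | true  = contradiction (trans (sym (C-closed u v u∈C uv v∉X)) v∉C) λ ()

  P-twins : ∀ {p q} → (p ∈ᵇ P) ≡ true → (q ∈ᵇ P) ≡ true → ∀ v → v ≢ p → v ≢ q → adj G p v ≡ adj G q v
  P-twins {p} {q} p∈P q∈P v v≢p v≢q with v ∈ᵇ X in v∈X
  ... | true = trans (P-nbhd p v p∈P v∈X) (sym (P-nbhd q v q∈P v∈X))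
  ... | false with v ∈ᵇ C in v∈C
  ...   | true  = trans (C-clique p v (P⊆C p p∈P) v∈C (v≢p ∘ sym)) (sym (C-clique q v (P⊆C q q∈P) v∈C (v≢q ∘ sym)))
  ...   | false = trans (C-nonadjacent (P⊆C p p∈P) v∈C v∈X) (sym (C-nonadjacent (P⊆C q q∈P) v∈C v∈X))

  SmallClasses : Labelling n → Set
  SmallClasses lab = ∀ v → classSize lab (lab v) ≤ h

  abstract
    free : Labelling n → Fin n → Bool
    free lab u = (u ∈ᵇ C) ∧ not (does (any? λ x → ((x ∈ᵇ X) ∧ (lab x ≡ᵇ lab u)) Bool.≟ true))

    free⇒∈C : ∀ lab {u} → free lab u ≡ true → (u ∈ᵇ C) ≡ true
    free⇒∈C lab = proj₁ ∘ ∧-true⁻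

    free⇒apart : ∀ lab {u} → free lab u ≡ true → ∀ x → (x ∈ᵇ X) ≡ true → lab x ≢ lab u
    free⇒apart lab {u} u-free x x∈X x≡u
      with any? (λ x → ((x ∈ᵇ X) ∧ (lab x ≡ᵇ lab u)) Bool.≟ true) | proj₂ (∧-true⁻ {u ∈ᵇ C} u-free)
    ... | no none | _ = none (x , trans (cong (_∧ _) x∈X) (dec-true (lab x ℕ.≟ lab u) x≡u))

    free-intro : ∀ lab {u} → (u ∈ᵇ C) ≡ true → (∀ x → (x ∈ᵇ X) ≡ true → lab x ≢ lab u) → free lab u ≡ true
    free-intro lab {u} u∈C apart with any? (λ x → ((x ∈ᵇ X) ∧ (lab x ≡ᵇ lab u)) Bool.≟ true)
    ... | no _             = trans (∧-identityʳ _) u∈C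
    ... | yes (x , shared) with ∧-true⁻ shared
    ...   | x∈X , same = contradiction (does-true⁻ (lab x ℕ.≟ lab u) same) (apart x x∈X)

    ¬free⇒shared : ∀ lab {u} → (u ∈ᵇ C) ≡ true → free lab u ≡ false → ∃[ x ] (x ∈ᵇ X) ≡ true × lab x ≡ lab u
    ¬free⇒shared lab {u} u∈C u-bound with any? (λ x → ((x ∈ᵇ X) ∧ (lab x ≡ᵇ lab u)) Bool.≟ true)
    ... | no _ rewrite u∈C = contradiction u-bound λ ()
    ... | yes (x , shared) with ∧-true⁻ shared
    ...   | x∈X , same = x , x∈X , does-true⁻ (lab x ℕ.≟ lab u) same

  Confined : Labelling n → Set
  Confined lab = ∀ u v → free lab u ≡ true → lab v ≡ lab u → (v ∈ᵇ C) ≡ true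

  Admissible : Labelling n → Set
  Admissible lab = SmallClasses lab × Confined lab

  escape : ∀ {E : Fin n → Fin n → Bool} → (∀ {u v} → E u v ≡ true → adj G u v ≡ true) →
           ∀ {a v} → Reach E a v → (a ∈ᵇ C) ≡ true → (v ∈ᵇ C) ≡ true ⊎ ∃[ x ] (x ∈ᵇ X) ≡ true × Reach E a x
  escape E⊆G here a∈C = inj₁ a∈C
  escape E⊆G {a} (step {w = w} e r) a∈C with w ∈ᵇ X in w∈X
  ... | true  = inj₂ (w , w∈X , step e here)
  ... | false with escape E⊆G r (C-closed a w a∈C (E⊆G e) w∈X)
  ...   | inj₁ v∈C           = inj₁ v∈C
  ...   | inj₂ (x , x∈X , r′) = inj₂ (x , x∈X , step e r′)

  connected-classes-confined : ∀ {E : Fin n → Fin n → Bool} → (∀ {u v} → E u v ≡ true → adj G u v ≡ true) →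
    ∀ lab → (∀ {u v} → lab u ≡ lab v → Reach E u v) → (∀ {u v} → Reach E u v → lab u ≡ lab v) → Confined lab
  connected-classes-confined E⊆G lab connected labelled u v u-free v≡u
    with escape E⊆G (connected (sym v≡u)) (free⇒∈C lab u-free)
  ... | inj₁ v∈C            = v∈C
  ... | inj₂ (x , x∈X , u↝x) = contradiction (sym (labelled u↝x)) (free⇒apart lab u-free x x∈X)

  degree : Fin n → ℕ
  degree u = count (adj G u)

  clique-row : ∀ (lab : Labelling n) {u} m → (u ∈ᵇ C) ≡ true → (∀ v → lab v ≡ m → (v ∈ᵇ C) ≡ true) →
               ∀ v → v ≢ u → χ (adj G u v ∧ not (m ≡ᵇ lab v)) + χ (lab v ≡ᵇ m) ≡ χ (adj G u v)
  clique-row lab {u} m u∈C class⊆C v v≢u with lab v ≡ᵇ m in same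
  ... | true  = trans (cong₂ (λ a b → χ (a ∧ not b) + 1) adjacent (trans (≡ᵇ-sym m (lab v)) same))
                      (cong χ (sym adjacent))
    where
    adjacent : adj G u v ≡ true
    adjacent = C-clique u v u∈C (class⊆C v (does-true⁻ (lab v ℕ.≟ m) same)) (v≢u ∘ sym)
  ... | false = trans (cong (λ b → χ (adj G u v ∧ not b) + 0) (trans (≡ᵇ-sym m (lab v)) same))
                      (trans (+-identityʳ _) (cong χ (∧-identityʳ _)))

  -- As u, its class and the class ℓ lie in the clique C, the row of u is its degree minus the rest of its class.
  module Move (lab : Labelling n) (u : Fin n) (ℓ : ℕ) (u∈C : (u ∈ᵇ C) ≡ true)
              (source⊆C : ∀ v → lab v ≡ lab u → (v ∈ᵇ C) ≡ true) (ℓ≢ : ℓ ≢ lab u)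
              (target⊆C : ∀ v → lab v ≡ ℓ → (v ∈ᵇ C) ≡ true) where

    lab′ : Labelling n
    lab′ = relabel lab u ℓ

    row-before : row (adj G) lab u + classSize lab (lab u) ≡ degree u + 1
    row-before =
      begin
        row (adj G) lab u + classSize lab (lab u) ≡⟨ ∑-distrib-+ (λ v → χ (adj G u v ∧ _)) _ ⟨
        sum f                                     ≡⟨ +-identityʳ _ ⟨
        sum f + 0                                 ≡⟨ cong (λ b → sum f + χ b) (irrefl G u) ⟨
        sum f + χ (adj G u u)                     ≡⟨ sum-update f (χ ∘ adj G u) u (clique-row lab (lab u) u∈C source⊆C) ⟩
        degree u + f u
          ≡⟨ cong₂ (λ a b → degree u + (χ (a ∧ not b) + χ b)) (irrefl G u) (dec-true (lab u ℕ.≟ lab u) refl) ⟩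
        degree u + 1                              ∎
      where
      open ≡-Reasoning
      f : Fin n → ℕ
      f v = χ (adj G u v ∧ not (lab u ≡ᵇ lab v)) + χ (lab v ≡ᵇ lab u)

    row-after : row (adj G) lab′ u + classSize lab ℓ ≡ degree u
    row-after =
      begin
        row (adj G) lab′ u + classSize lab ℓ                       ≡⟨ ∑-distrib-+ (λ v → χ (adj G u v ∧ _)) _ ⟨
        sum (λ v → χ (adj G u v ∧ not (lab′ u ≡ᵇ lab′ v)) + χ (lab v ≡ᵇ ℓ)) ≡⟨ sum-cong-≗ entry ⟩
        degree u                                                     ∎
      where
      open ≡-Reasoning
      entry : ∀ v → χ (adj G u v ∧ not (lab′ u ≡ᵇ lab′ v)) + χ (lab v ≡ᵇ ℓ) ≡ χ (adj G u v)
      entry v with v Fin.≟ u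
      ... | yes refl rewrite irrefl G v | dec-false (lab v ℕ.≟ ℓ) (ℓ≢ ∘ sym) = refl
      ... | no v≢u rewrite relabel-self lab u ℓ = clique-row lab ℓ u∈C target⊆C v v≢u

    cut-move : cut (adj G) lab′ + 2 + (classSize lab ℓ + classSize lab ℓ)
               ≡ cut (adj G) lab + (classSize lab (lab u) + classSize lab (lab u))
    cut-move = +-cancelʳ-≡ (r′ + r′) _ _
      (begin
        c′ + 2 + (new + new) + (r′ + r′)       ≡⟨ regroup₁ c′ new r′ ⟩
        c′ + ((r′ + new) + (r′ + new)) + 2     ≡⟨ cong (λ z → c′ + (z + z) + 2) row-after ⟩
        c′ + (degree u + degree u) + 2         ≡⟨ regroup₂ c′ (degree u) ⟩
        c′ + ((degree u + 1) + (degree u + 1)) ≡⟨ cong (λ z → c′ + (z + z)) row-before ⟨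
        c′ + ((r + old) + (r + old))           ≡⟨ regroup₃ c′ r old ⟩
        c′ + (r + r) + (old + old)
          ≡⟨ cong (_+ (old + old)) (cut-update (adj G) (adj-sym G) (irrefl G) lab lab′ u agree) ⟨
        c + (r′ + r′) + (old + old)            ≡⟨ regroup₄ c r′ old ⟩
        c + (old + old) + (r′ + r′)            ∎)
      where
      open ≡-Reasoning
      c = cut (adj G) lab
      c′ = cut (adj G) lab′
      r = row (adj G) lab u
      r′ = row (adj G) lab′ u
      old = classSize lab (lab u)
      new = classSize lab ℓ
      agree : ∀ w → w ≢ u → lab w ≡ lab′ w
      agree w w≢u = sym (relabel-other lab u ℓ w≢u)
      regroup₁ : ∀ a b c → a + 2 + (b + b) + (c + c) ≡ a + ((c + b) + (c + b)) + 2
      regroup₁ = solve-∀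
      regroup₂ : ∀ a b → a + (b + b) + 2 ≡ a + ((b + 1) + (b + 1))
      regroup₂ = solve-∀
      regroup₃ : ∀ a b c → a + ((b + c) + (b + c)) ≡ a + (b + b) + (c + c)
      regroup₃ = solve-∀
      regroup₄ : ∀ a b c → a + (b + b) + (c + c) ≡ a + (c + c) + (b + b)
      regroup₄ = solve-∀

  LocallyOptimal : Labelling n → Set
  LocallyOptimal lab = ∀ u w → free lab u ≡ true → free lab w ≡ true → lab u ≢ lab w →
                       classSize lab (lab u) ≤ classSize lab (lab w) → h ≤ classSize lab (lab w)

  Improvable : Labelling n → Fin n → Fin n → Set
  Improvable lab u w = free lab u ≡ true × free lab w ≡ true × lab u ≢ lab w ×
                       classSize lab (lab u) ≤ classSize lab (lab w) × classSize lab (lab w) < h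

  improvable? : ∀ lab u w → Dec (Improvable lab u w)
  improvable? lab u w = free lab u Bool.≟ true ×-dec free lab w Bool.≟ true ×-dec ¬? (lab u ℕ.≟ lab w) ×-dec
                        classSize lab (lab u) ℕ.≤? classSize lab (lab w) ×-dec classSize lab (lab w) ℕ.<? h

  module Improve (lab : Labelling n) (small : SmallClasses lab) (confined : Confined lab) (u w : Fin n)
                 (u-free : free lab u ≡ true) (w-free : free lab w ≡ true) (u≢w : lab u ≢ lab w)
                 (|u|≤|w| : classSize lab (lab u) ≤ classSize lab (lab w)) (|w|<h : classSize lab (lab w) < h) where

    open Move lab u (lab w) (free⇒∈C lab u-free) (λ v → confined u v u-free) (u≢w ∘ sym) (λ v → confined w v w-free)
      using (lab′; cut-move) public

    cut-decreases : cut (adj G) lab′ < cut (adj G) lab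
    cut-decreases = <-≤-trans (m<m+n (cut (adj G) lab′) (s≤s z≤n))
      (+-cancelʳ-≤ (|w| + |w|) _ _ (≤-trans (≤-reflexive cut-move) (+-monoʳ-≤ (cut (adj G) lab) (+-mono-≤ |u|≤|w| |u|≤|w|))))
      where |w| = classSize lab (lab w)

    class-bound : ∀ x → classSize lab′ (lab x) ≤ h
    class-bound x =
      ≤-trans (m≤m+n _ _) (≤-trans (≤-reflexive (classSize-relabel lab u (lab w) (lab x))) (by-cases (lab w ≡ᵇ lab x) refl))
      where
      by-cases : ∀ b → (lab w ≡ᵇ lab x) ≡ b → classSize lab (lab x) + χ b ≤ h
      by-cases true  same = subst (λ m → classSize lab m + 1 ≤ h) (does-true⁻ (lab w ℕ.≟ lab x) same)
                                  (subst (_≤ h) (+-comm 1 _) |w|<h)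
      by-cases false _    = subst (_≤ h) (sym (+-identityʳ _)) (small x)

    small′ : SmallClasses lab′
    small′ v with v Fin.≟ u
    ... | yes refl = class-bound w
    ... | no _     = class-bound v

    confined′ : Confined lab′
    confined′ a b a-free′ same = by-cases (b Fin.≟ u) (a Fin.≟ u)
      where
      by-cases : Dec (b ≡ u) → Dec (a ≡ u) → (b ∈ᵇ C) ≡ true
      by-cases (yes refl) _ = free⇒∈C lab u-free
      by-cases (no b≢u) (yes refl) =
        confined w b w-free (trans (sym (relabel-other lab a (lab w) b≢u)) (trans same (relabel-self lab a (lab w))))
      by-cases (no b≢u) (no a≢u) =
        confined a b a-free (trans (sym (relabel-other lab u (lab w) b≢u)) (trans same (relabel-other lab u (lab w) a≢u)))
        where
        a-free : free lab a ≡ true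
        a-free = free-intro lab (free⇒∈C lab′ a-free′) λ x x∈X x≡a → free⇒apart lab′ a-free′ x x∈X
          (trans (relabel-other lab u (lab w) (C≢X (free⇒∈C lab u-free) x∈X ∘ sym))
                 (trans x≡a (sym (relabel-other lab u (lab w) a≢u))))

    admissible : Admissible lab′
    admissible = small′ , confined′

  descend : ∀ lab → Admissible lab →
            Σ[ lab′ ∈ Labelling n ] Admissible lab′ × cut (adj G) lab′ ≤ cut (adj G) lab × LocallyOptimal lab′
  descend lab adm = go lab adm (<-wellFounded (cut (adj G) lab))
    where
    go : ∀ lab → Admissible lab → Acc _<_ (cut (adj G) lab) →
         Σ[ lab′ ∈ Labelling n ] Admissible lab′ × cut (adj G) lab′ ≤ cut (adj G) lab × LocallyOptimal lab′
    go lab adm@(small , confined) (acc smaller) with any? (λ u → any? (λ w → improvable? lab u w))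
    ... | yes (u , w , u-free , w-free , u≢w , |u|≤|w| , |w|<h) =
      let open Improve lab small confined u w u-free w-free u≢w |u|≤|w| |w|<h
          (lab″ , adm″ , cut≤ , optimal) = go lab′ admissible (smaller cut-decreases)
      in lab″ , adm″ , ≤-trans cut≤ (<⇒≤ cut-decreases) , optimal
    ... | no none = lab , adm , ≤-refl , λ u w u-free w-free u≢w |u|≤|w| →
      ≮⇒≥ λ |w|<h → none (u , w , u-free , w-free , u≢w , |u|≤|w| , |w|<h)

  X-avoids : ∀ (W : Subset n) → (∀ v → (v ∈ᵇ W) ≡ true → (v ∈ᵇ C) ≡ true) →
             ∀ v → (v ∈ᵇ X) ≡ true → (v ∈ᵇ W) ≡ false
  X-avoids W W⊆C v v∈X with v ∈ᵇ W in v∈W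
  ... | false = refl
  ... | true  = contradiction (trans (sym v∈X) (C∩X-empty v (W⊆C v v∈W))) λ ()

  -- Each vertex x of X shares its class with at most h - 1 vertices of P.
  nonfree-P-bound : ∀ lab → SmallClasses lab → count (λ v → (v ∈ᵇ P) ∧ not (free lab v)) ≤ count (_∈ᵇ X) * (h ∸ 1)
  nonfree-P-bound lab small =
    begin
      count (λ v → (v ∈ᵇ P) ∧ not (free lab v)) ≤⟨ sum-mono nonfree⇒shared ⟩
      sum (λ v → sum λ x → shares v x)          ≡⟨ ∑-comm shares ⟩
      sum (λ x → sum λ v → shares v x)          ≤⟨ sum-mono sharing-bound ⟩
      sum (λ x → χ (x ∈ᵇ X) * (h ∸ 1))          ≡⟨ *-distribʳ-sum (h ∸ 1) (χ ∘ (_∈ᵇ X)) ⟨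
      count (_∈ᵇ X) * (h ∸ 1)                   ∎
    where
    open ≤-Reasoning
    shares : Fin n → Fin n → ℕ
    shares v x = χ ((x ∈ᵇ X) ∧ ((v ∈ᵇ P) ∧ (lab v ≡ᵇ lab x)))
    nonfree⇒shared : ∀ v → χ ((v ∈ᵇ P) ∧ not (free lab v)) ≤ sum (shares v)
    nonfree⇒shared v with free lab v in v-free
    ... | true  = subst (_≤ sum (shares v)) (cong χ (sym (∧-zeroʳ (v ∈ᵇ P)))) z≤n
    ... | false = by-membership (v ∈ᵇ P) refl
      where
      by-membership : ∀ b → (v ∈ᵇ P) ≡ b → χ (b ∧ true) ≤ sum (shares v)
      by-membership false _   = z≤n
      by-membership true  v∈P with ¬free⇒shared lab (P⊆C v v∈P) v-free
      ... | x , x∈X , x≡v = ≤-trans (≤-reflexive (sym shares≡1)) (sum-≥-entry (shares v) x)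
        where
        shares≡1 : shares v x ≡ 1
        shares≡1 rewrite x∈X | v∈P | dec-true (lab v ℕ.≟ lab x) (sym x≡v) = refl
    sharing-bound : ∀ x → sum (λ v → shares v x) ≤ χ (x ∈ᵇ X) * (h ∸ 1)
    sharing-bound x with x ∈ᵇ X in x∈X
    ... | false = ≤-reflexive (sum-replicate-zero n)
    ... | true  = subst (count (λ v → (v ∈ᵇ P) ∧ (lab v ≡ᵇ lab x)) ≤_) (sym (+-identityʳ (h ∸ 1)))
                        (∸-monoˡ-≤ 1 (≤-trans others<class (small x)))
      where
      others<class : count (λ v → (v ∈ᵇ P) ∧ (lab v ≡ᵇ lab x)) < classSize lab (lab x)
      others<class = sum-mono-< (λ v → χ-∧≤ʳ (v ∈ᵇ P) _) x
        (subst₂ (λ p q → χ (p ∧ (lab x ≡ᵇ lab x)) < χ q) (sym (X-avoids P P⊆C x x∈X))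
                (sym (dec-true (lab x ℕ.≟ lab x) refl)) (s≤s z≤n))

  free-P-many : ∀ lab → SmallClasses lab → h ≤ count (λ v → (v ∈ᵇ P) ∧ free lab v)
  free-P-many lab small = +-cancelˡ-≤ (count (_∈ᵇ X) * (h ∸ 1)) _ _
    (begin
      count (_∈ᵇ X) * (h ∸ 1) + h                                ≤⟨ P-large ⟩
      count (_∈ᵇ P)                                              ≡⟨ sum-cong-≗ (λ v → χ-split (v ∈ᵇ P) (free lab v)) ⟩
      sum (λ v → χ ((v ∈ᵇ P) ∧ free lab v) + χ ((v ∈ᵇ P) ∧ not (free lab v)))
                                                                 ≡⟨ ∑-distrib-+ (λ v → χ ((v ∈ᵇ P) ∧ free lab v)) _ ⟩
      count (λ v → (v ∈ᵇ P) ∧ free lab v) + count (λ v → (v ∈ᵇ P) ∧ not (free lab v))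
                                                                 ≤⟨ +-monoʳ-≤ _ (nonfree-P-bound lab small) ⟩
      count (λ v → (v ∈ᵇ P) ∧ free lab v) + count (_∈ᵇ X) * (h ∸ 1) ≡⟨ +-comm (count (λ v → (v ∈ᵇ P) ∧ free lab v)) _ ⟩
      count (_∈ᵇ X) * (h ∸ 1) + count (λ v → (v ∈ᵇ P) ∧ free lab v) ∎)
    where open ≤-Reasoning

  full-free-class : ∀ lab → Admissible lab → LocallyOptimal lab → 1 ≤ h →
                    ∃[ r ] free lab r ≡ true × classSize lab (lab r) ≡ h
  full-free-class lab (small , _) optimal 1≤h
    with count-<-witness (λ _ → false) (λ v → (v ∈ᵇ P) ∧ free lab v)
                         (subst (_< count (λ v → (v ∈ᵇ P) ∧ free lab v)) (sym (sum-replicate-zero n))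
                                (≤-trans 1≤h (free-P-many lab small)))
  ... | w₀ , _ , w₀∈P∩free with proj₂ (∧-true⁻ {w₀ ∈ᵇ P} w₀∈P∩free) | classSize lab (lab w₀) ℕ.≟ h
  ...   | w₀-free | yes full = w₀ , w₀-free , full
  ...   | w₀-free | no ¬full
    with count-<-witness (λ v → free lab v ∧ (lab v ≡ᵇ lab w₀)) (free lab) (<-≤-trans s₀<h free-many)
    where
    s₀<h : count (λ v → free lab v ∧ (lab v ≡ᵇ lab w₀)) < h
    s₀<h = ≤-<-trans (sum-mono λ v → χ-∧≤ʳ (free lab v) _) (≤∧≢⇒< (small w₀) ¬full)
    free-many : h ≤ count (free lab)
    free-many = ≤-trans (free-P-many lab small) (sum-mono λ v → χ-∧≤ʳ (v ∈ᵇ P) _)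
  ...     | w₁ , w₁∉class , w₁-free with ∧-≡ᵇ-false⇒≢ w₁∉class w₁-free | ≤-total (classSize lab (lab w₀)) (classSize lab (lab w₁))
  ...       | w₁≢w₀ | inj₁ s₀≤s₁ = w₁ , w₁-free , ≤-antisym (small w₁) (optimal w₀ w₁ w₀-free w₁-free (w₁≢w₀ ∘ sym) s₀≤s₁)
  ...       | w₁≢w₀ | inj₂ s₁≤s₀ = contradiction (≤-antisym (small w₀) (optimal w₁ w₀ w₁-free w₀-free w₁≢w₀ s₁≤s₀)) ¬full

  module Swap (a b : Fin n) (a∈C : (a ∈ᵇ C) ≡ true) (b∈C : (b ∈ᵇ C) ≡ true) where

    swap : Fin n → Fin n
    swap = transpose a b

    swap-preserves : ∀ (f : Fin n → Bool) → f a ≡ f b → ∀ x → f (swap x) ≡ f x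
    swap-preserves f fa≡fb x = by-cases (x Fin.≟ a) (x Fin.≟ b)
      where
      by-cases : Dec (x ≡ a) → Dec (x ≡ b) → f (swap x) ≡ f x
      by-cases (yes refl) _          = trans (cong f (transpose-matchˡ a b)) (sym fa≡fb)
      by-cases (no _)     (yes refl) = trans (cong f (transpose-matchʳ a b)) fa≡fb
      by-cases (no x≢a)   (no x≢b)   = cong f (transpose-other a b x≢a x≢b)

    swap-C : ∀ x → (swap x ∈ᵇ C) ≡ (x ∈ᵇ C)
    swap-C = swap-preserves (_∈ᵇ C) (trans a∈C (sym b∈C))

    swap-X : ∀ x → (swap x ∈ᵇ X) ≡ (x ∈ᵇ X)
    swap-X = swap-preserves (_∈ᵇ X) (trans (C∩X-empty a a∈C) (sym (C∩X-empty b b∈C)))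

    module _ (lab : Labelling n) where

      classSize-swap : ∀ m → classSize (lab ∘ swap) m ≡ classSize lab m
      classSize-swap m = count-permute (Perm.transpose a b) (λ v → lab v ≡ᵇ m)

      free-swap : ∀ v → free (lab ∘ swap) v ≡ free lab (swap v)
      free-swap v = ≡true-⇔⇒≡
        (λ v-free → free-intro lab (trans (swap-C v) (free⇒∈C (lab ∘ swap) v-free)) λ x x∈X x≡v →
           free⇒apart (lab ∘ swap) v-free (swap x) (trans (swap-X x) x∈X) (trans (cong lab (transpose-involutive a b x)) x≡v))
        (λ v-free → free-intro (lab ∘ swap) (trans (sym (swap-C v)) (free⇒∈C lab v-free)) λ x x∈X →
           free⇒apart lab v-free (swap x) (trans (swap-X x) x∈X))

      admissible-swap : Admissible lab → Admissible (lab ∘ swap)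
      admissible-swap (small , confined) =
        (λ v → subst (_≤ h) (sym (classSize-swap (lab (swap v)))) (small (swap v))) ,
        (λ u v u-free same → trans (sym (swap-C v)) (confined (swap u) (swap v) (trans (sym (free-swap u)) u-free) same))

  -- Twins in P: the transposition is an automorphism of G.
  cut-twin-swap : ∀ {p q} (p∈P : (p ∈ᵇ P) ≡ true) (q∈P : (q ∈ᵇ P) ≡ true) lab →
                  cut (adj G) (lab ∘ transpose p q) ≡ cut (adj G) lab
  cut-twin-swap {p} {q} p∈P q∈P = cut-permute (adj G) (Perm.transpose p q)
    (transpose-twins (adj G) p q (adj-sym G) (trans (irrefl G p) (sym (irrefl G q))) (P-twins p∈P q∈P))

  -- Two moves inside the clique C whose effects on the cut cancel.
  cut-free-swap : ∀ lab → Admissible lab → ∀ {u k} → free lab u ≡ true → free lab k ≡ true → lab u ≢ lab k →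
                  cut (adj G) (lab ∘ transpose u k) ≡ cut (adj G) lab
  cut-free-swap lab (_ , confined) {u} {k} u-free k-free u≢k =
    begin
      cut (adj G) (lab ∘ transpose u k) ≡⟨ cut-cong (adj G) two-moves ⟨
      cut (adj G) lab₂                  ≡⟨ two-moves-cancel (cut (adj G) lab) (cut (adj G) lab₁) _ A B M₁-move M₂-move ⟩
      cut (adj G) lab                   ∎
    where
    open ≡-Reasoning
    u∈C = free⇒∈C lab u-free
    k≢u : k ≢ u
    k≢u = u≢k ∘ cong lab ∘ sym
    module M₁ = Move lab u (lab k) u∈C (λ v → confined u v u-free) (u≢k ∘ sym) (λ v → confined k v k-free)
    lab₁ = M₁.lab′
    lab₁-k : lab₁ k ≡ lab k
    lab₁-k = relabel-other lab u (lab k) k≢u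
    class₁ : ∀ {v} ℓ → lab₁ v ≡ ℓ → v ≢ u → lab v ≡ ℓ
    class₁ {v} ℓ same v≢u = trans (sym (relabel-other lab u (lab k) v≢u)) same
    within-C : ∀ w → free lab w ≡ true → ∀ v → lab₁ v ≡ lab w → (v ∈ᵇ C) ≡ true
    within-C w w-free v same = by-cases (v Fin.≟ u)
      where
      by-cases : Dec (v ≡ u) → (v ∈ᵇ C) ≡ true
      by-cases (yes refl) = u∈C
      by-cases (no v≢u)   = confined w v w-free (class₁ (lab w) same v≢u)
    module M₂ = Move lab₁ k (lab u) (free⇒∈C lab k-free) (λ v same → within-C k k-free v (trans same lab₁-k))
                     (λ same → u≢k (trans same lab₁-k)) (within-C u u-free)
    lab₂ = M₂.lab′
    two-moves : ∀ x → lab₂ x ≡ lab (transpose u k x)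
    two-moves x = by-cases (x Fin.≟ k) (x Fin.≟ u)
      where
      by-cases : Dec (x ≡ k) → Dec (x ≡ u) → lab₂ x ≡ lab (transpose u k x)
      by-cases (yes refl) _ = trans (relabel-self lab₁ x (lab u)) (cong lab (sym (transpose-matchʳ u x)))
      by-cases (no x≢k) (yes refl) = trans (relabel-other lab₁ k (lab x) x≢k)
                                      (trans (relabel-self lab x (lab k)) (cong lab (sym (transpose-matchˡ x k))))
      by-cases (no x≢k) (no x≢u) = trans (relabel-other lab₁ k (lab u) x≢k)
                                      (trans (relabel-other lab u (lab k) x≢u) (cong lab (sym (transpose-other u k x≢u x≢k))))
    A = classSize lab₁ (lab u)
    B = classSize lab (lab k)
    A+1 : classSize lab (lab u) ≡ A + 1
    A+1 = sym (classSize-leave lab u (lab k) (u≢k ∘ sym))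
    B+1 : classSize lab₁ (lab₁ k) ≡ B + 1
    B+1 = trans (cong (classSize lab₁) lab₁-k) (classSize-join lab u (lab k) (u≢k ∘ sym))
    M₁-move : cut (adj G) lab₁ + 2 + (B + B) ≡ cut (adj G) lab + ((A + 1) + (A + 1))
    M₁-move = trans M₁.cut-move (cong (λ z → cut (adj G) lab + (z + z)) A+1)
    M₂-move : cut (adj G) lab₂ + 2 + (A + A) ≡ cut (adj G) lab₁ + ((B + 1) + (B + 1))
    M₂-move = trans M₂.cut-move (cong (λ z → cut (adj G) lab₁ + (z + z)) B+1)

  record Anchored (ℓ₀ : ℕ) (lab : Labelling n) : Set where
    field
      admissible   : Admissible lab
      anchor       : Fin n
      anchor-free  : free lab anchor ≡ true
      anchor-label : lab anchor ≡ ℓ₀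
      full         : classSize lab ℓ₀ ≡ h

  misplaced : ℕ → Labelling n → ℕ
  misplaced ℓ₀ lab = count λ a → (a ∈ᵇ S) ∧ not (lab a ≡ᵇ ℓ₀)

  module _ (ℓ₀ : ℕ) (lab : Labelling n) {s t : Fin n}
           (s∈S : (s ∈ᵇ S) ≡ true) (s∉ℓ₀ : lab s ≢ ℓ₀) (t∉S : (t ∈ᵇ S) ≡ false) where

    private
      misplaced-at : Labelling n → Fin n → ℕ
      misplaced-at l a = χ ((a ∈ᵇ S) ∧ not (l a ≡ᵇ ℓ₀))

      misplaced-at-s : misplaced-at lab s ≡ 1
      misplaced-at-s rewrite s∈S | dec-false (lab s ℕ.≟ ℓ₀) s∉ℓ₀ = refl

      pointwise : ∀ a → misplaced-at (lab ∘ transpose s t) a ≤ misplaced-at lab a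
      pointwise a = by-cases (a Fin.≟ s) (a Fin.≟ t)
        where
        by-cases : Dec (a ≡ s) → Dec (a ≡ t) → misplaced-at (lab ∘ transpose s t) a ≤ misplaced-at lab a
        by-cases (yes refl) _          = subst (misplaced-at (lab ∘ transpose s t) s ≤_) (sym misplaced-at-s) (χ≤1 _)
        by-cases (no _)     (yes refl) rewrite t∉S = z≤n
        by-cases (no a≢s)   (no a≢t)   rewrite transpose-other s t a≢s a≢t = ≤-refl

    misplaced-swap-≤ : misplaced ℓ₀ (lab ∘ transpose s t) ≤ misplaced ℓ₀ lab
    misplaced-swap-≤ = sum-mono pointwise

    misplaced-swap-< : lab (transpose s t s) ≡ ℓ₀ → misplaced ℓ₀ (lab ∘ transpose s t) < misplaced ℓ₀ lab
    misplaced-swap-< placed = sum-mono-< pointwise s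
      (subst₂ _<_ (sym (trans (cong (λ z → χ ((s ∈ᵇ S) ∧ not z)) (dec-true (lab (transpose s t s) ℕ.≟ ℓ₀) placed))
                              (cong (λ z → χ (z ∧ false)) s∈S)))
                  (sym misplaced-at-s) (s≤s z≤n))

  S-deficit : ∀ (f : Fin n → Bool) {s} → (s ∈ᵇ S) ≡ true → f s ≡ false → count (λ a → (a ∈ᵇ S) ∧ f a) < h
  S-deficit f {s} s∈S fs = subst (count (λ a → (a ∈ᵇ S) ∧ f a) <_) |S|≡h (sum-mono-< (λ a → χ-∧≤ˡ (a ∈ᵇ S) (f a)) s strict)
    where
    strict : χ ((s ∈ᵇ S) ∧ f s) < χ (s ∈ᵇ S)
    strict rewrite s∈S | fs = s≤s z≤n

  Progress : ℕ → Labelling n → Set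
  Progress ℓ₀ lab = Σ[ lab′ ∈ Labelling n ] Anchored ℓ₀ lab′ × cut (adj G) lab′ ≡ cut (adj G) lab ×
                                          misplaced ℓ₀ lab′ < misplaced ℓ₀ lab

  progress-trans : ∀ {ℓ₀ lab lab′} → cut (adj G) lab′ ≡ cut (adj G) lab → misplaced ℓ₀ lab′ ≤ misplaced ℓ₀ lab →
                   Progress ℓ₀ lab′ → Progress ℓ₀ lab
  progress-trans cut≡ fewer (lab″ , anchored″ , cut≡′ , fewer′) = lab″ , anchored″ , trans cut≡′ cut≡ , <-≤-trans fewer′ fewer

  -- Exchange a free misplaced vertex of S with a vertex of the class ℓ₀ outside S.
  free-step : ∀ {ℓ₀ lab} → Anchored ℓ₀ lab → ∀ {s} → (s ∈ᵇ S) ≡ true → free lab s ≡ true → lab s ≢ ℓ₀ → Progress ℓ₀ lab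
  free-step {ℓ₀} {lab} anchored {s} s∈S s-free s∉ℓ₀
    with count-<-witness (λ a → (a ∈ᵇ S) ∧ (lab a ≡ᵇ ℓ₀)) (λ a → lab a ≡ᵇ ℓ₀)
           (subst (count (λ a → (a ∈ᵇ S) ∧ (lab a ≡ᵇ ℓ₀)) <_) (sym (Anchored.full anchored))
                  (S-deficit (λ a → lab a ≡ᵇ ℓ₀) s∈S (dec-false (lab s ℕ.≟ ℓ₀) s∉ℓ₀)))
  ... | k , k∉S∩ℓ₀ , k∈ℓ₀ =
    lab ∘ transpose s k , anchored′ , cut-free-swap lab admissible s-free k-free (s∉ℓ₀ ∘ (λ same → trans same k≡ℓ₀)) ,
    misplaced-swap-< ℓ₀ lab s∈S s∉ℓ₀ (∧-false⇒false k∉S∩ℓ₀ k∈ℓ₀) (trans (cong lab (transpose-matchˡ s k)) k≡ℓ₀)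
    where
    open Anchored anchored
    k≡ℓ₀ : lab k ≡ ℓ₀
    k≡ℓ₀ = does-true⁻ (lab k ℕ.≟ ℓ₀) k∈ℓ₀
    k≡anchor : lab k ≡ lab anchor
    k≡anchor = trans k≡ℓ₀ (sym anchor-label)
    k-free : free lab k ≡ true
    k-free = free-intro lab (proj₂ admissible anchor k anchor-free k≡anchor) λ x x∈X x≡k →
      free⇒apart lab anchor-free x x∈X (trans x≡k k≡anchor)
    open Swap s k (free⇒∈C lab s-free) (free⇒∈C lab k-free)
    anchored′ : Anchored ℓ₀ (lab ∘ transpose s k)
    anchored′ = record
      { admissible   = admissible-swap lab admissible
      ; anchor       = s
      ; anchor-free  = trans (free-swap lab s) (trans (cong (free lab) (transpose-matchˡ s k)) k-free)
      ; anchor-label = trans (cong lab (transpose-matchˡ s k)) k≡ℓ₀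
      ; full         = trans (classSize-swap lab ℓ₀) full
      }

  -- Exchange a non-free misplaced vertex of S with a free twin in P outside S; it becomes free,
  -- and unless it landed in ℓ₀ a free step follows.
  twin-step : ∀ {ℓ₀ lab} → Anchored ℓ₀ lab → ∀ {s} → (s ∈ᵇ S) ≡ true → free lab s ≡ false → lab s ≢ ℓ₀ → Progress ℓ₀ lab
  twin-step {ℓ₀} {lab} anchored {s} s∈S s-bound s∉ℓ₀
    with count-<-witness (λ v → (v ∈ᵇ S) ∧ free lab v) (λ v → (v ∈ᵇ P) ∧ free lab v)
           (<-≤-trans (S-deficit (free lab) s∈S s-bound) (free-P-many lab (proj₁ (Anchored.admissible anchored))))
  ... | y , y∉S∩free , y∈P∩free = finish (lab (transpose s y s) ℕ.≟ ℓ₀)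
    where
    open Anchored anchored
    y∈P = proj₁ (∧-true⁻ {y ∈ᵇ P} y∈P∩free)
    y-free = proj₂ (∧-true⁻ {y ∈ᵇ P} y∈P∩free)
    y∉S = ∧-false⇒false y∉S∩free y-free
    open Swap s y (P⊆C s (S⊆P s s∈S)) (P⊆C y y∈P)
    anchored′ : Anchored ℓ₀ (lab ∘ transpose s y)
    anchored′ = record
      { admissible   = admissible-swap lab admissible
      ; anchor       = transpose s y anchor
      ; anchor-free  = trans (free-swap lab _) (trans (cong (free lab) (transpose-involutive s y anchor)) anchor-free)
      ; anchor-label = trans (cong lab (transpose-involutive s y anchor)) anchor-label
      ; full         = trans (classSize-swap lab ℓ₀) full
      }
    s-free′ : free (lab ∘ transpose s y) s ≡ true
    s-free′ = trans (free-swap lab s) (trans (cong (free lab) (transpose-matchˡ s y)) y-free)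
    finish : Dec (lab (transpose s y s) ≡ ℓ₀) → Progress ℓ₀ lab
    finish (yes placed) = lab ∘ transpose s y , anchored′ , cut-twin-swap (S⊆P s s∈S) y∈P lab ,
                          misplaced-swap-< ℓ₀ lab s∈S s∉ℓ₀ y∉S placed
    finish (no s∉ℓ₀′) = progress-trans {lab = lab} {lab ∘ transpose s y}
                          (cut-twin-swap (S⊆P s s∈S) y∈P lab) (misplaced-swap-≤ ℓ₀ lab s∈S s∉ℓ₀ y∉S)
                                       (free-step anchored′ s∈S s-free′ s∉ℓ₀′)

  place : ∀ {ℓ₀ lab} → Anchored ℓ₀ lab → ∀ {s} → (s ∈ᵇ S) ≡ true → lab s ≢ ℓ₀ → Progress ℓ₀ lab
  place {lab = lab} anchored {s} s∈S s∉ℓ₀ with free lab s in s-free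
  ... | true  = free-step anchored s∈S s-free s∉ℓ₀
  ... | false = twin-step anchored s∈S s-free s∉ℓ₀

  Gathered : ℕ → Labelling n → Set
  Gathered ℓ₀ lab = Σ[ lab′ ∈ Labelling n ] Anchored ℓ₀ lab′ × cut (adj G) lab′ ≡ cut (adj G) lab ×
                                          (∀ a → (a ∈ᵇ S) ≡ true → lab′ a ≡ ℓ₀)

  gather : ∀ {ℓ₀ lab} → Anchored ℓ₀ lab → Gathered ℓ₀ lab
  gather {ℓ₀} {lab} anchored = go lab anchored (<-wellFounded (misplaced ℓ₀ lab))
    where
    go : ∀ lab → Anchored ℓ₀ lab → Acc _<_ (misplaced ℓ₀ lab) → Gathered ℓ₀ lab
    go lab anchored (acc smaller) with any? (λ a → ((a ∈ᵇ S) ∧ not (lab a ≡ᵇ ℓ₀)) Bool.≟ true)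
    ... | yes (s , mis) = continue (place anchored s∈S (does-false⁻ (lab s ℕ.≟ ℓ₀) (not-true⁻ s∉ℓ₀)))
      where
      s∈S = proj₁ (∧-true⁻ {s ∈ᵇ S} mis)
      s∉ℓ₀ = proj₂ (∧-true⁻ {s ∈ᵇ S} mis)
      continue : Progress ℓ₀ lab → Gathered ℓ₀ lab
      continue (lab′ , anchored′ , cut≡ , fewer) with go lab′ anchored′ (smaller fewer)
      ... | lab″ , anchored″ , cut≡′ , placed = lab″ , anchored″ , trans cut≡′ cut≡ , placed
    ... | no none = lab , anchored , refl , placed
      where
      placed : ∀ a → (a ∈ᵇ S) ≡ true → lab a ≡ ℓ₀
      placed a a∈S with lab a ℕ.≟ ℓ₀
      ... | yes a∈ℓ₀ = a∈ℓ₀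
      ... | no  a∉ℓ₀ = contradiction (a , cong₂ (λ x y → x ∧ not y) a∈S (dec-false (lab a ℕ.≟ ℓ₀) a∉ℓ₀)) none

  class-is-S : ∀ lab ℓ₀ → classSize lab ℓ₀ ≡ h → (∀ a → (a ∈ᵇ S) ≡ true → lab a ≡ ℓ₀) →
               ∀ a → lab a ≡ ℓ₀ → (a ∈ᵇ S) ≡ true
  class-is-S lab ℓ₀ full S⊆ℓ₀ a a∈ℓ₀ with a ∈ᵇ S in a∈S
  ... | true  = refl
  ... | false = contradiction (sum-mono-< pointwise a strict) (subst₂ (λ x y → ¬ x < y) (sym |S|≡h) (sym full) (<-irrefl refl))
    where
    pointwise : ∀ b → χ (b ∈ᵇ S) ≤ χ (lab b ≡ᵇ ℓ₀)
    pointwise b with b ∈ᵇ S in b∈S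
    ... | false = z≤n
    ... | true  = ≤-reflexive (cong χ (sym (dec-true (lab b ℕ.≟ ℓ₀) (S⊆ℓ₀ b b∈S))))
    strict : χ (a ∈ᵇ S) < χ (lab a ≡ᵇ ℓ₀)
    strict rewrite a∈S | dec-true (lab a ℕ.≟ ℓ₀) a∈ℓ₀ = s≤s z≤n

  R : ℕ
  R = (count (_∈ᵇ C) ∸ h) + count (_∈ᵇ T)

  S⊆C : ∀ v → (v ∈ᵇ S) ≡ true → (v ∈ᵇ C) ≡ true
  S⊆C v = P⊆C v ∘ S⊆P v

  count-C-minus-S : count (λ v → (v ∈ᵇ C) ∧ not (v ∈ᵇ S)) ≡ count (_∈ᵇ C) ∸ h
  count-C-minus-S = sym
    (begin
      count (_∈ᵇ C) ∸ h
        ≡⟨ cong (_∸ h) (sum-cong-≗ λ v → χ-split (v ∈ᵇ C) (v ∈ᵇ S)) ⟩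
      sum (λ v → χ ((v ∈ᵇ C) ∧ (v ∈ᵇ S)) + χ ((v ∈ᵇ C) ∧ not (v ∈ᵇ S))) ∸ h
        ≡⟨ cong (_∸ h) (∑-distrib-+ (λ v → χ ((v ∈ᵇ C) ∧ (v ∈ᵇ S))) _) ⟩
      count (λ v → (v ∈ᵇ C) ∧ (v ∈ᵇ S)) + count (λ v → (v ∈ᵇ C) ∧ not (v ∈ᵇ S)) ∸ h
        ≡⟨ cong (λ z → z + count (λ v → (v ∈ᵇ C) ∧ not (v ∈ᵇ S)) ∸ h) (trans (sum-cong-≗ C∩S≡S) |S|≡h) ⟩
      h + count (λ v → (v ∈ᵇ C) ∧ not (v ∈ᵇ S)) ∸ h
        ≡⟨ m+n∸m≡n h _ ⟩
      count (λ v → (v ∈ᵇ C) ∧ not (v ∈ᵇ S)) ∎)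
    where
    open ≡-Reasoning
    C∩S≡S : ∀ v → χ ((v ∈ᵇ C) ∧ (v ∈ᵇ S)) ≡ χ (v ∈ᵇ S)
    C∩S≡S v with v ∈ᵇ S in v∈S
    ... | true  rewrite S⊆C v v∈S = refl
    ... | false = cong χ (∧-zeroʳ _)

  -- A vertex of S is adjacent to all of C except itself and to exactly T in X.
  S-outside-degree : ∀ s → (s ∈ᵇ S) ≡ true → count (λ v → adj G s v ∧ not (v ∈ᵇ S)) ≡ R
  S-outside-degree s s∈S =
    begin
      count (λ v → adj G s v ∧ not (v ∈ᵇ S))                       ≡⟨ sum-cong-≗ neighbour ⟩
      sum (λ v → χ ((v ∈ᵇ C) ∧ not (v ∈ᵇ S)) + χ (v ∈ᵇ T))         ≡⟨ ∑-distrib-+ (λ v → χ ((v ∈ᵇ C) ∧ not (v ∈ᵇ S))) _ ⟩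
      count (λ v → (v ∈ᵇ C) ∧ not (v ∈ᵇ S)) + count (_∈ᵇ T)       ≡⟨ cong (_+ count (_∈ᵇ T)) count-C-minus-S ⟩
      R                                                            ∎
    where
    open ≡-Reasoning
    s∈P = S⊆P s s∈S
    s∈C = S⊆C s s∈S
    neighbour : ∀ v → χ (adj G s v ∧ not (v ∈ᵇ S)) ≡ χ ((v ∈ᵇ C) ∧ not (v ∈ᵇ S)) + χ (v ∈ᵇ T)
    neighbour v with v ∈ᵇ X in v∈X
    ... | true rewrite P-nbhd s v s∈P v∈X | X-avoids C (λ _ v∈C → v∈C) v v∈X | X-avoids S S⊆C v v∈X = cong χ (∧-identityʳ _)
    ... | false with v ∈ᵇ T in v∈T
    ...   | true = contradiction (trans (sym (T⊆X v v∈T)) v∈X) λ ()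
    ...   | false with v ∈ᵇ C in v∈C
    ...     | false rewrite C-nonadjacent s∈C v∈C v∈X = refl
    ...     | true with v Fin.≟ s
    ...       | yes refl rewrite irrefl G v | s∈S = refl
    ...       | no v≢s rewrite C-clique s v s∈C v∈C (v≢s ∘ sym) = sym (+-identityʳ _)

  leaves-S : Fin n → Fin n → ℕ
  leaves-S u v = χ ((u ∈ᵇ S) ∧ (adj G u v ∧ not (v ∈ᵇ S)))

  S-boundary : sum (λ u → sum (leaves-S u)) ≡ h * R
  S-boundary =
    begin
      sum (λ u → sum (leaves-S u))  ≡⟨ sum-cong-≗ row-of-S ⟩
      sum (λ u → χ (u ∈ᵇ S) * R)    ≡⟨ *-distribʳ-sum R (χ ∘ (_∈ᵇ S)) ⟨
      count (_∈ᵇ S) * R             ≡⟨ cong (_* R) |S|≡h ⟩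
      h * R                         ∎
    where
    open ≡-Reasoning
    row-of-S : ∀ u → sum (leaves-S u) ≡ χ (u ∈ᵇ S) * R
    row-of-S u with u ∈ᵇ S in u∈S
    ... | true  = trans (S-outside-degree u u∈S) (sym (+-identityʳ R))
    ... | false = sum-replicate-zero n

  -- If S is exactly the class ℓ₀, every edge leaving S is cut and the other edges of G - S are cut as before.
  cut-around-S : ∀ (lab : Labelling n) ℓ₀ → (∀ a → (a ∈ᵇ S) ≡ true → lab a ≡ ℓ₀) → (∀ a → lab a ≡ ℓ₀ → (a ∈ᵇ S) ≡ true) →
                 ∀ u v → χ (adj G u v ∧ not (lab u ≡ᵇ lab v))
                         ≡ χ (induced G (∁ S) u v ∧ not (lab u ≡ᵇ lab v)) + leaves-S u v + leaves-S v u
  cut-around-S lab ℓ₀ S⊆ℓ₀ ℓ₀⊆S u v rewrite ∈ᵇ-∁ S u | ∈ᵇ-∁ S v | adj-sym G v u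
    with adj G u v | u ∈ᵇ S in u∈S | v ∈ᵇ S in v∈S | lab u ≡ᵇ lab v in same
  ... | false | true  | true  | _     = refl
  ... | false | true  | false | _     = refl
  ... | false | false | true  | _     = refl
  ... | false | false | false | _     = refl
  ... | true  | true  | true  | true  = refl
  ... | true  | true  | true  | false = contradiction (trans (S⊆ℓ₀ u u∈S) (sym (S⊆ℓ₀ v v∈S))) (does-false⁻ (lab u ℕ.≟ lab v) same)
  ... | true  | true  | false | true  =
    contradiction (trans (sym (ℓ₀⊆S v (trans (sym (does-true⁻ (lab u ℕ.≟ lab v) same)) (S⊆ℓ₀ u u∈S)))) v∈S) λ ()
  ... | true  | true  | false | false = refl
  ... | true  | false | true  | true  =
    contradiction (trans (sym (ℓ₀⊆S u (trans (does-true⁻ (lab u ℕ.≟ lab v) same) (S⊆ℓ₀ v v∈S)))) u∈S) λ ()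
  ... | true  | false | true  | false = refl
  ... | true  | false | false | true  = refl
  ... | true  | false | false | false = refl

  removal : ∀ lab ℓ₀ → (∀ a → (a ∈ᵇ S) ≡ true → lab a ≡ ℓ₀) → (∀ a → lab a ≡ ℓ₀ → (a ∈ᵇ S) ≡ true) →
            cut (adj G) lab ≡ cut (induced G (∁ S)) lab + (h * R + h * R)
  removal lab ℓ₀ S⊆ℓ₀ ℓ₀⊆S =
    begin
      cut (adj G) lab
        ≡⟨ sum-cong-≗ (λ u → sum-cong-≗ (cut-around-S lab ℓ₀ S⊆ℓ₀ ℓ₀⊆S u)) ⟩
      sum (λ u → sum λ v → A u v + leaves-S u v + leaves-S v u)
        ≡⟨ sum-cong-≗ (λ u → trans (∑-distrib-+ (λ v → A u v + leaves-S u v) _)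
                                   (cong (_+ sum (λ v → leaves-S v u)) (∑-distrib-+ (A u) (leaves-S u)))) ⟩
      sum (λ u → sum (A u) + sum (leaves-S u) + sum (λ v → leaves-S v u))
        ≡⟨ trans (∑-distrib-+ (λ u → sum (A u) + sum (leaves-S u)) _)
                 (cong (_+ sum (λ u → sum λ v → leaves-S v u)) (∑-distrib-+ (λ u → sum (A u)) (λ u → sum (leaves-S u)))) ⟩
      cut (induced G (∁ S)) lab + sum (λ u → sum (leaves-S u)) + sum (λ u → sum λ v → leaves-S v u)
        ≡⟨ cong (λ z → cut (induced G (∁ S)) lab + sum (λ u → sum (leaves-S u)) + z) (∑-comm (λ u v → leaves-S v u)) ⟩
      cut (induced G (∁ S)) lab + sum (λ u → sum (leaves-S u)) + sum (λ v → sum (leaves-S v))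
        ≡⟨ cong₂ (λ x y → cut (induced G (∁ S)) lab + x + y) S-boundary S-boundary ⟩
      cut (induced G (∁ S)) lab + h * R + h * R
        ≡⟨ +-assoc (cut (induced G (∁ S)) lab) _ _ ⟩
      cut (induced G (∁ S)) lab + (h * R + h * R) ∎
    where
    open ≡-Reasoning
    A : Fin n → Fin n → ℕ
    A u v = χ (induced G (∁ S) u v ∧ not (lab u ≡ᵇ lab v))

  small⇒classes : ∀ lab → SmallClasses lab → ∀ W → ClassesAtMost G W lab h
  small⇒classes lab small W v _ = ≤-trans (sum-mono λ u → χ-∧≤ʳ (u ∈ᵇ W) _) (small v)

  forward : ∀ lab → Admissible lab → 1 ≤ h →
            Σ[ lab′ ∈ Labelling n ] ClassesAtMost G (∁ S) lab′ h ×
              cut (induced G (∁ S)) lab′ + (h * R + h * R) ≤ cut (adj G) lab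
  forward lab adm 1≤h with descend lab adm
  ... | lab₁ , adm₁ , cut₁≤ , optimal with full-free-class lab₁ adm₁ optimal 1≤h
  ...   | r , r-free , full
    with gather {lab₁ r} (record { admissible = adm₁ ; anchor = r ; anchor-free = r-free ; anchor-label = refl ; full = full })
  ...     | lab₂ , anchored₂ , cut₂≡ , S⊆ℓ₀ =
    lab₂ , small⇒classes lab₂ (proj₁ admissible) (∁ S) ,
    (begin
      cut (induced G (∁ S)) lab₂ + (h * R + h * R)
        ≡⟨ removal lab₂ (lab₁ r) S⊆ℓ₀ (class-is-S lab₂ (lab₁ r) (Anchored.full anchored₂) S⊆ℓ₀) ⟨
      cut (adj G) lab₂                              ≡⟨ cut₂≡ ⟩
      cut (adj G) lab₁                              ≤⟨ cut₁≤ ⟩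
      cut (adj G) lab                               ∎)
    where
    open ≤-Reasoning
    open Anchored anchored₂ using (admissible)

  backward : ∀ lab′ → ClassesAtMost G (∁ S) lab′ h →
             Σ[ lab ∈ Labelling n ] ClassesAtMost G ⊤ lab h × cut (adj G) lab ≡ cut (induced G (∁ S)) lab′ + (h * R + h * R)
  backward lab′ classes′ = lab , classes , trans (removal lab 0 S⊆0 0⊆S) (cong (_+ (h * R + h * R)) same-cut)
    where
    lab : Labelling n
    lab v = if v ∈ᵇ S then 0 else suc (lab′ v)
    S⊆0 : ∀ a → (a ∈ᵇ S) ≡ true → lab a ≡ 0
    S⊆0 a a∈S rewrite a∈S = refl
    0⊆S : ∀ a → lab a ≡ 0 → (a ∈ᵇ S) ≡ true
    0⊆S a a∈0 with a ∈ᵇ S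
    ... | true = refl
    same-cut : cut (induced G (∁ S)) lab ≡ cut (induced G (∁ S)) lab′
    same-cut = sum-cong-≗ λ u → sum-cong-≗ λ v → entry u v
      where
      entry : ∀ u v → χ (induced G (∁ S) u v ∧ not (lab u ≡ᵇ lab v)) ≡ χ (induced G (∁ S) u v ∧ not (lab′ u ≡ᵇ lab′ v))
      entry u v rewrite ∈ᵇ-∁ S u | ∈ᵇ-∁ S v with adj G u v | u ∈ᵇ S | v ∈ᵇ S
      ... | false | _     | _     = refl
      ... | true  | true  | _     = refl
      ... | true  | false | true  = refl
      ... | true  | false | false = refl
    classes : ClassesAtMost G ⊤ lab h
    classes v _ with v ∈ᵇ S in v∈S
    ... | true  = ≤-reflexive (trans (sum-cong-≗ in-class-0) |S|≡h)
      where
      in-class-0 : ∀ u → χ ((u ∈ᵇ ⊤) ∧ (lab u ≡ᵇ 0)) ≡ χ (u ∈ᵇ S)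
      in-class-0 u rewrite ∈ᵇ-⊤ u with u ∈ᵇ S
      ... | true  = refl
      ... | false = refl
    ... | false = ≤-trans (≤-reflexive (sum-cong-≗ shifted)) (classes′ v (∈ᵇ⇒∈ (trans (∈ᵇ-∁ S v) (cong not v∈S))))
      where
      shifted : ∀ u → χ ((u ∈ᵇ ⊤) ∧ (lab u ≡ᵇ suc (lab′ v))) ≡ χ ((u ∈ᵇ ∁ S) ∧ (lab′ u ≡ᵇ lab′ v))
      shifted u rewrite ∈ᵇ-⊤ u | ∈ᵇ-∁ S u with u ∈ᵇ S
      ... | true  = refl
      ... | false = refl

  cut-⊤ : ∀ lab → cut (induced G ⊤) lab ≡ cut (adj G) lab
  cut-⊤ lab = sum-cong-≗ λ a → sum-cong-≗ λ b → cong (λ e → χ (e ∧ not (lab a ≡ᵇ lab b))) (induced-⊤ a b)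
    where
    induced-⊤ : ∀ a b → induced G ⊤ a b ≡ adj G a b
    induced-⊤ a b rewrite ∈ᵇ-⊤ a | ∈ᵇ-⊤ b = ∧-identityʳ (adj G a b)

  classes⇒small : ∀ lab → ClassesAtMost G ⊤ lab h → SmallClasses lab
  classes⇒small lab classes v = subst (_≤ h) (sum-cong-≗ λ u → cong (λ b → χ (b ∧ (lab u ≡ᵇ lab v))) (∈ᵇ-⊤ u)) (classes v ∈⊤)

  yes-forward : ∀ k → 1 ≤ h → YesInstance G ⊤ k h → YesInstance G (∁ S) (k ℤ.- + (h * R)) h
  yes-forward k 1≤h (F , |F|≤k , components) = reduce (forward component (small , confined) 1≤h)
    where
    open Solution G ⊤ F
    small : SmallClasses component
    small = classes⇒small component (component-classes h components)
    confined : Confined component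
    confined = connected-classes-confined (remaining⇒adj G ⊤ F) component component≡⇒Reach Reach⇒component≡
    reduce : Σ[ lab′ ∈ Labelling n ] ClassesAtMost G (∁ S) lab′ h ×
               cut (induced G (∁ S)) lab′ + (h * R + h * R) ≤ cut (adj G) component →
             YesInstance G (∁ S) (k ℤ.- + (h * R)) h
    reduce (lab′ , classes′ , bound) =
      separate G (∁ S) lab′ , +≤⇒≤- |F′| (h * R) (ℤₚ.≤-trans (ℤ.+≤+ budget) |F|≤k) ,
      separate-components G (∁ S) lab′ h classes′
      where
      |F′| = pairCount (del (separate G (∁ S) lab′))
      budget : |F′| + h * R ≤ pairCount (del F)
      budget = halve-≤ (begin
        (|F′| + h * R) + (|F′| + h * R)                      ≡⟨ regroup |F′| (h * R) ⟩
        (|F′| + |F′|) + (h * R + h * R)                      ≡⟨ cong (_+ (h * R + h * R)) (pairCount-separate G (∁ S) lab′) ⟩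
        cut (induced G (∁ S)) lab′ + (h * R + h * R)          ≤⟨ bound ⟩
        cut (adj G) component                                ≡⟨ cut-⊤ component ⟨
        cut (induced G ⊤) component                          ≤⟨ cut-component ⟩
        pairCount (del F) + pairCount (del F)                ∎)
        where
        open ≤-Reasoning
        regroup : ∀ a b → (a + b) + (a + b) ≡ (a + a) + (b + b)
        regroup = solve-∀

  yes-backward : ∀ k → YesInstance G (∁ S) (k ℤ.- + (h * R)) h → YesInstance G ⊤ k h
  yes-backward k (F′ , |F′|≤k′ , components′) = extend (backward component (component-classes h components′))
    where
    open Solution G (∁ S) F′
    extend : Σ[ lab ∈ Labelling n ] ClassesAtMost G ⊤ lab h ×
               cut (adj G) lab ≡ cut (induced G (∁ S)) component + (h * R + h * R) →
             YesInstance G ⊤ k h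
    extend (lab , classes , cut≡) =
      separate G ⊤ lab , ℤₚ.≤-trans (ℤ.+≤+ budget) (≤-⇒+≤ (pairCount (del F′)) (h * R) |F′|≤k′) ,
      separate-components G ⊤ lab h classes
      where
      |F| = pairCount (del (separate G ⊤ lab))
      budget : |F| ≤ pairCount (del F′) + h * R
      budget = halve-≤ (begin
        |F| + |F|                                                      ≡⟨ pairCount-separate G ⊤ lab ⟩
        cut (induced G ⊤) lab                                          ≡⟨ cut-⊤ lab ⟩
        cut (adj G) lab                                                ≡⟨ cut≡ ⟩
        cut (induced G (∁ S)) component + (h * R + h * R)              ≤⟨ +-monoˡ-≤ (h * R + h * R) cut-component ⟩
        (pairCount (del F′) + pairCount (del F′)) + (h * R + h * R)   ≡⟨ regroup (pairCount (del F′)) (h * R) ⟩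
        (pairCount (del F′) + h * R) + (pairCount (del F′) + h * R)   ∎)
        where
        open ≤-Reasoning
        regroup : ∀ a b → (a + a) + (b + b) ≡ (a + b) + (a + b)
        regroup = solve-∀

any-true : ∀ {A : Set} (p : A → Bool) {x} xs → x ∈ₗ xs → p x ≡ true → any p xs ≡ true
any-true p (y ∷ ys) (here refl) py = cong (_∨ any p ys) py
any-true p (y ∷ ys) (there x∈ys) px = trans (cong (p y ∨_) (any-true p ys x∈ys px)) (∨-zeroʳ (p y))

any-false : ∀ {A : Set} (p : A → Bool) xs → (∀ y → p y ≡ false) → any p xs ≡ false
any-false p []       none = refl
any-false p (y ∷ ys) none = cong₂ _∨_ (none y) (any-false p ys none)

setting : ∀ {n} (G : Graph n) (h : ℕ) (X C : Subset n) → ClusterAfterDeleting G X → IsComponentOf G X C →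
          (T P : Subset n) → T ⊆ X →
          (∀ v → (v ∈ P → v ∈ C × nbhd G v ∩ X ≡ T) × (v ∈ C → nbhd G v ∩ X ≡ T → v ∈ P)) →
          ∣ X ∣ * (h ∸ 1) + h ≤ ∣ P ∣ → (S : Subset n) → S ⊆ P → ∣ S ∣ ≡ h → Setting G X C T P S h
setting G h X C cluster (_ , component) T P T⊆X P-class P-large S S⊆P |S|≡h = record
  { C∩X-empty = C∩X-empty
  ; C-closed  = λ u v u∈C uv v∉X → ∈⇒∈ᵇ (proj₂ (component u v (∈ᵇ⇒∈ u∈C)) (∈ᵇ⇒∉ v∉X) (step (edge u∈C uv v∉X) here))
  ; C-clique  = λ u v u∈C v∈C → cluster u v (∈ᵇ⇒∉ (C∩X-empty u u∈C)) (∈ᵇ⇒∉ (C∩X-empty v v∈C))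
                                        (proj₂ (proj₁ (component u v (∈ᵇ⇒∈ u∈C)) (∈ᵇ⇒∈ v∈C)))
  ; P⊆C       = λ v v∈P → ∈⇒∈ᵇ (proj₁ (proj₁ (P-class v) (∈ᵇ⇒∈ v∈P)))
  ; P-nbhd    = P-nbhd
  ; T⊆X       = λ x → ∈⇒∈ᵇ ∘ T⊆X ∘ ∈ᵇ⇒∈
  ; S⊆P       = λ v → ∈⇒∈ᵇ ∘ S⊆P ∘ ∈ᵇ⇒∈
  ; |S|≡h     = trans (sym (∣∣≡count S)) |S|≡h
  ; P-large   = subst₂ (λ x p → x * (h ∸ 1) + h ≤ p) (∣∣≡count X) (∣∣≡count P) P-large
  }
  where
  C∩X-empty : ∀ v → (v ∈ᵇ C) ≡ true → (v ∈ᵇ X) ≡ false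
  C∩X-empty v v∈C = ∉⇒∈ᵇ (proj₁ (proj₁ (component v v (∈ᵇ⇒∈ v∈C)) (∈ᵇ⇒∈ v∈C)))
  edge : ∀ {u v} → (u ∈ᵇ C) ≡ true → adj G u v ≡ true → (v ∈ᵇ X) ≡ false → induced G (∁ X) u v ≡ true
  edge {u} {v} u∈C uv v∉X rewrite ∈ᵇ-∁ X u | ∈ᵇ-∁ X v | uv | C∩X-empty u u∈C | v∉X = refl
  P-nbhd : ∀ p x → (p ∈ᵇ P) ≡ true → (x ∈ᵇ X) ≡ true → adj G p x ≡ (x ∈ᵇ T)
  P-nbhd p x p∈P x∈X =
    begin
      adj G p x                              ≡⟨ ∧-identityʳ (adj G p x) ⟨
      adj G p x ∧ true                       ≡⟨ cong (adj G p x ∧_) x∈X ⟨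
      adj G p x ∧ (x ∈ᵇ X)                   ≡⟨ cong (_∧ (x ∈ᵇ X)) (lookup∘tabulate (adj G p) x) ⟨
      (x ∈ᵇ nbhd G p) ∧ (x ∈ᵇ X)             ≡⟨ lookup-zipWith _∧_ x (nbhd G p) X ⟨
      x ∈ᵇ (nbhd G p ∩ X)                    ≡⟨ cong (x ∈ᵇ_) (proj₂ (proj₁ (P-class p) (∈ᵇ⇒∈ p∈P))) ⟩
      x ∈ᵇ T                                 ∎
    where open ≡-Reasoning

module _ {n} {G : Graph n} {X C T P S : Subset n} {h : ℕ} (σ : Setting G X C T P S h) where

  open Setting σ
  open Reduction σ

  NX-size : ∀ {p₀} → (p₀ ∈ᵇ P) ≡ true → ∣ NX G X P ∣ ≡ count (_∈ᵇ T)
  NX-size {p₀} p₀∈P = trans (∣∣≡count (NX G X P)) (sum-cong-≗ λ x → cong χ (trans (lookup∘tabulate in-NX x) (entry x)))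
    where
    in-NX : Fin n → Bool
    in-NX x = (x ∈ᵇ X) ∧ any (λ p → (p ∈ᵇ P) ∧ adj G p x) (allFin n)
    entry : ∀ x → in-NX x ≡ (x ∈ᵇ T)
    entry x with x ∈ᵇ X in x∈X | x ∈ᵇ T in x∈T
    ... | false | false = refl
    ... | false | true  = contradiction (trans (sym (T⊆X x x∈T)) x∈X) λ ()
    ... | true  | true  = any-true _ (allFin n) (∈-allFin p₀) (cong₂ _∧_ p₀∈P (trans (P-nbhd p₀ x p₀∈P x∈X) x∈T))
    ... | true  | false = any-false _ (allFin n) not-adjacent
      where
      not-adjacent : ∀ p → ((p ∈ᵇ P) ∧ adj G p x) ≡ false
      not-adjacent p with p ∈ᵇ P in p∈P
      ... | false = refl
      ... | true  = trans (P-nbhd p x p∈P x∈X) x∈T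

  h≤|C| : h ≤ count (_∈ᵇ C)
  h≤|C| = subst (_≤ count (_∈ᵇ C)) |S|≡h (sum-mono S≤C)
    where
    S≤C : ∀ v → χ (v ∈ᵇ S) ≤ χ (v ∈ᵇ C)
    S≤C v with v ∈ᵇ S in v∈S
    ... | false = z≤n
    ... | true  rewrite S⊆C v v∈S = s≤s z≤n

-- N_X(P) = T needs a vertex of P, which exists once h ≥ 1; for h = 0 both sides vanish.
penalty : ∀ {n} {G : Graph n} {X C T P S : Subset n} h (σ : Setting G X C T P S h) →
          + h ℤ.* ((+ ∣ C ∣ ℤ.- + h) ℤ.+ + ∣ NX G X P ∣) ≡ + (h * Reduction.R σ)
penalty zero    σ = refl
penalty {n} {G} {X} {C} {T} {P} (suc h) σ
  with count-<-witness (λ _ → false) (_∈ᵇ P)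
         (subst₂ ℕ._<_ (sym (sum-replicate-zero n)) refl (≤-trans (s≤s z≤n) (≤-trans (m≤n+m _ _) (Setting.P-large σ))))
... | p₀ , _ , p₀∈P =
  begin
    + suc h ℤ.* ((+ ∣ C ∣ ℤ.- + suc h) ℤ.+ + ∣ NX G X P ∣)
      ≡⟨ cong₂ (λ c t → + suc h ℤ.* ((+ c ℤ.- + suc h) ℤ.+ + t)) (∣∣≡count C) (NX-size σ p₀∈P) ⟩
    + suc h ℤ.* ((+ count (_∈ᵇ C) ℤ.- + suc h) ℤ.+ + count (_∈ᵇ T))
      ≡⟨ cong (λ d → + suc h ℤ.* (d ℤ.+ + count (_∈ᵇ T))) (trans (ℤₚ.m-n≡m⊖n (count (_∈ᵇ C)) (suc h)) (ℤₚ.⊖-≥ (h≤|C| σ))) ⟩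
    + suc h ℤ.* (+ (count (_∈ᵇ C) ∸ suc h) ℤ.+ + count (_∈ᵇ T))
      ≡⟨ cong (+ suc h ℤ.*_) (ℤₚ.pos-+ (count (_∈ᵇ C) ∸ suc h) (count (_∈ᵇ T))) ⟨
    + suc h ℤ.* + (count (_∈ᵇ C) ∸ suc h + count (_∈ᵇ T))
      ≡⟨ ℤₚ.pos-* (suc h) (count (_∈ᵇ C) ∸ suc h + count (_∈ᵇ T)) ⟨
    + (suc h * Reduction.R σ) ∎
  where open ≡-Reasoning

lemma2 : ∀ {n : ℕ} (G : Graph n) (k : ℤ) (h : ℕ) (X C : Subset n) →
    ClusterAfterDeleting G X →
    IsComponentOf G X C →
    (T P : Subset n) → T ⊆ X →
    (∀ v → (v ∈ P → v ∈ C × nbhd G v ∩ X ≡ T) × (v ∈ C → nbhd G v ∩ X ≡ T → v ∈ P)) →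
    ∣ X ∣ * (h ∸ 1) + h ≤ ∣ P ∣ →
    (S : Subset n) → S ⊆ P → ∣ S ∣ ≡ h →
    YesInstance G ⊤ k h
      ⇔ YesInstance G (∁ S) (k ℤ.- + h ℤ.* ((+ ∣ C ∣ ℤ.- + h) ℤ.+ + ∣ NX G X P ∣)) h
lemma2 G k h X C cluster component T P T⊆X P-class P-large S S⊆P |S|≡h =
  mk⇔ (λ yes → subst reduced (sym (penalty h σ)) (yes-forward k (YesInstance⇒1≤h yes (∈⊤ {x = c})) yes))
      (λ yes → yes-backward k (subst reduced (penalty h σ) yes))
  where
  c = proj₁ (proj₁ component)
  σ = setting G h X C cluster component T P T⊆X P-class P-large S S⊆P |S|≡h
  open Reduction σ
  reduced : ℤ → Set
  reduced d = YesInstance G (∁ S) (k ℤ.- d) h
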